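{- Let $W=L_{i_1}^{\epsilon_1}L_{i_2}^{\epsilon_2}\cdots L_{i_{2n}}^{\epsilon_{2n}}$ be a multidimensional Dyck word and $\Gamma$ its digraph. Then $$\rho(W)=\frac{1}{N^n}\,C_c(\Gamma;N).$$
   Context: Fix a nonzero integer $N$. For $\sigma\in\mathfrak S_n$ let $c_m(\sigma)$ be its number of $m$-cycles and $\phi_N(\sigma)=\prod_{m\ge2}(1/N)^{(m-1)c_m(\sigma)}$. Let $\mathcal H$ be a complex Hilbert space with orthonormal basis $(e_i)$. $\mathcal F_N(\mathcal H)$ is obtained from the algebraic full Fock space with the form $\langle\xi_1\otimes\cdots\otimes\xi_m,\eta_1\otimes\cdots\otimes\eta_n\rangle_N=\delta_{mn}\sum_{\sigma\in\mathfrak S_n}\phi_N(\sigma)\prod_i\langle\xi_i,\eta_{\sigma^{ -1}(i)}\rangle$ by dividing out the kernel and completing; $\Omega$ is the vacuum. $L_N(\xi)$ is left tensoring by $\xi$; $L_N^*(\xi)\Omega=0$, $L_N^*(\xi)\xi_1\otimes\cdots\otimes\xi_n=\langle\xi,\xi_1\rangle\xi_2\otimes\cdots\otimes\xi_n+\frac1N\sum_{k=2}^n\langle\xi,\xi_k\rangle\xi_2\otimes\cdots\otimes\xi_{k-1}\otimes\xi_1\otimes\xi_{k+1}\otimes\cdots\otimes\xi_n$. $\rho(X)=\langle\Omega,X\Omega\rangle_N$. $L_i=L_N(e_i)$, $L_i^1=L_i$, $L_i^*=L_N^*(e_i)$. A word $W=L_{i_1}^{\epsilon_1}\cdots L_{i_{2n}}^{\epsilon_{2n}}$,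 $\epsilon_j\in\{*,1\}$, is a multidimensional Dyck word if for every color $i$ and every $0\le j\le 2n$, the number of $l>j$ with $i_l=i,\epsilon_l=1$ is at least the number of $l>j$ with $i_l=i,\epsilon_l=*$, with equality for $j=0$. Let $p(1)<\dots<p(n)$ be the positions of the annihilators ($\epsilon=*$) and let $\pi$ be the unique noncrossing pair partition of $\{1,\dots,2n\}$ whose pairs are $\{p<q\}$ with $\epsilon_p=*,\epsilon_q=1$; write $\pi(p)$ for the partner of $p$. The digraph $\Gamma$ has vertices $v_1,\dots,v_n$ and a directed edge $v_r\to v_s$ (loops allowed) iff $i_{p(r)}=i_{\pi(p(s))}$ and $\pi(p(s))>p(r)$. A cycle cover of $\Gamma$ is a set of vertex-disjoint directed cycles (a loop counting as a cycle of length 1) covering all vertices; the cycle cover polynomial is $C_c(\Gamma;x)=\sum_C x^{|C|}$, summed over cycle covers $C$, $|C|$ the number of cycles. -}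

module Defs where

open import Data.Nat as ℕ using (ℕ; zero; suc; _≡ᵇ_; _<ᵇ_; _≤_)
open import Data.Integer as ℤ using (ℤ; +_; -[1+_])
open import Data.Rational as ℚ using (ℚ; 0ℚ; 1ℚ)
open import Data.Bool using (Bool; true; false; if_then_else_; _∧_; not)
open import Data.List as List using (List; []; _∷_; _++_; [_]; map; concatMap; foldr; drop; length; allFin; filter)
open import Data.Fin as Fin using (Fin; toℕ)
open import Data.Vec as Vec using (Vec)
open import Data.Product using (_×_; _,_; proj₁; proj₂)
open import Relation.Binary.PropositionalEquality using (_≡_; _≢_; refl)
open import Data.Empty using (⊥-elim)

invN : (N : ℤ) → N ≢ + 0 → ℚ
invN (+ zero)    nz = ⊥-elim (nz refl)
invN (+ (suc k)) nz = + 1 ℚ./ suc k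
invN -[1+ k ]    nz = ℤ.-[1+ 0 ] ℚ./ suc k

toℚ : ℤ → ℚ
toℚ N = N ℚ./ 1

pow : ℚ → ℕ → ℚ
pow x zero    = 1ℚ
pow x (suc k) = x ℚ.* pow x k

data Eps : Set where
  ann : Eps   -- ε = *  (annihilator L_i^*)
  cre : Eps   -- ε = 1  (creator L_i)

Letter : Set
Letter = ℕ × Eps

Word : Set
Word = List Letter

-- Representatives of vectors of the algebraic full Fock space over the
-- span of the orthonormal basis (e_i): formal ℚ-linear combinations of
-- elementary tensors e_{j_1} ⊗ ... ⊗ e_{j_m}  (the empty tensor = Ω).

Tensor : Set
Tensor = List ℕ

Vect : Set
Vect = List (ℚ × Tensor)

δ : ℕ → ℕ → ℚ
δ i j = if i ≡ᵇ j then 1ℚ else 0ℚ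

scale : ℚ → Vect → Vect
scale c = map (λ { (a , t) → (c ℚ.* a , t) })

creation : ℕ → Vect → Vect
creation i = map (λ { (a , t) → (a , i ∷ t) })

-- the terms  Σ_{k≥2} ⟨e_i, ξ_k⟩ ξ_2 ⊗ … ⊗ ξ_{k-1} ⊗ ξ_1 ⊗ ξ_{k+1} ⊗ … ,
-- with x = ξ_1, pre = ξ_2 … ξ_{k-1}, and the remaining list ξ_k …
swaps : ℕ → ℕ → Tensor → Tensor → Vect
swaps i x pre []       = []
swaps i x pre (y ∷ ys) = (δ i y , pre ++ (x ∷ ys)) ∷ swaps i x (pre ++ [ y ]) ys

-- L_N^*(e_i) on an elementary tensor; c is the scalar 1/N
annTensor : ℚ → ℕ → Tensor → Vect
annTensor c i []       = []
annTensor c i (x ∷ xs) = (δ i x , xs) ∷ scale c (swaps i x [] xs)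

annihilation : ℚ → ℕ → Vect → Vect
annihilation c i = concatMap (λ { (a , t) → scale a (annTensor c i t) })

act : ℚ → Letter → Vect → Vect
act c (i , ann) v = annihilation c i v
act c (i , cre) v = creation i v

-- W v, the rightmost letter acting first
applyWord : ℚ → Word → Vect → Vect
applyWord c W v = foldr (act c) v W

-- ⟨Ω , v⟩_N : only the degree-0 component contributes, and ⟨Ω,Ω⟩_N = 1
vacuumCoeff : Vect → ℚ
vacuumCoeff []              = 0ℚ
vacuumCoeff ((a , []) ∷ v)  = a ℚ.+ vacuumCoeff v
vacuumCoeff ((a , _ ∷ _) ∷ v) = vacuumCoeff v

Ωv : Vect
Ωv = (1ℚ , []) ∷ []

ρ : (N : ℤ) → N ≢ + 0 → Word → ℚ
ρ N nz W = vacuumCoeff (applyWord (invN N nz) W Ωv)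

countCre : ℕ → Word → ℕ
countCre i []              = 0
countCre i ((j , cre) ∷ w) = (if i ≡ᵇ j then 1 else 0) ℕ.+ countCre i w
countCre i ((j , ann) ∷ w) = countCre i w

countAnn : ℕ → Word → ℕ
countAnn i []              = 0
countAnn i ((j , ann) ∷ w) = (if i ≡ᵇ j then 1 else 0) ℕ.+ countAnn i w
countAnn i ((j , cre) ∷ w) = countAnn i w

-- drop j W = the letters at positions l > j (1-indexed)
record IsDyck (W : Word) : Set where
  field
    suffix : ∀ (i j : ℕ) → j ≤ length W → countAnn i (drop j W) ≤ countCre i (drop j W)
    total  : ∀ (i : ℕ) → countCre i W ≡ countAnn i W

-- Positions (0-indexed from here on), the pairing π and the digraph Γ

isAnn : Letter → Bool
isAnn (_ , ann) = true
isAnn (_ , cre) = false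

annPosFrom : ℕ → Word → List ℕ
annPosFrom q []            = []
annPosFrom q ((_ , ann) ∷ w) = q ∷ annPosFrom (suc q) w
annPosFrom q ((_ , cre) ∷ w) = annPosFrom (suc q) w

annPositions : Word → List ℕ
annPositions = annPosFrom 0

nAnn : Word → ℕ
nAnn W = length (annPositions W)

p : (W : Word) → Fin (nAnn W) → ℕ
p W r = List.lookup (annPositions W) r

-- bracket matching: d = number of still-open annihilators after the
-- one being matched, q = current position
matchFrom : ℕ → ℕ → Word → ℕ
matchFrom d       q []              = q
matchFrom d       q ((_ , ann) ∷ w) = matchFrom (suc d) (suc q) w
matchFrom zero    q ((_ , cre) ∷ w) = q
matchFrom (suc d) q ((_ , cre) ∷ w) = matchFrom d (suc q) w

-- π(p): partner of the annihilator at position p in the noncrossing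
-- pair partition {p < q}, ε_p = *, ε_q = 1
partner : Word → ℕ → ℕ
partner W q = matchFrom 0 (suc q) (drop (suc q) W)

colourAt : Word → ℕ → ℕ
colourAt []            k       = 0
colourAt ((i , _) ∷ w) zero    = i
colourAt (_ ∷ w)       (suc k) = colourAt w k

edge : (W : Word) → Fin (nAnn W) → Fin (nAnn W) → Bool
edge W r s = (colourAt W (p W r) ≡ᵇ colourAt W (partner W (p W s)))
             ∧ (p W r <ᵇ partner W (p W s))

-- A cycle cover is the same thing as a permutation σ of the vertices
-- such that v → σ(v) is an edge for every v (the cycles of σ are the
-- cycles of the cover, fixed points being loops).

allMaps : (m k : ℕ) → List (Vec (Fin m) k)
allMaps m zero    = Vec.[] ∷ []
allMaps m (suc k) = concatMap (λ x → map (x Vec.∷_) (allMaps m k)) (allFin m)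

allB : ∀ {n} → (Fin n → Bool) → Bool
allB {n} f = foldr (λ x b → f x ∧ b) true (allFin n)

countB : ∀ {n} → (Fin n → Bool) → ℕ
countB {n} f = List.length (filter (λ x → Data.Bool.T? (f x)) (allFin n))
  where import Data.Bool

eqF : ∀ {n} → Fin n → Fin n → Bool
eqF x y = toℕ x ≡ᵇ toℕ y

injectiveB : ∀ {n} → Vec (Fin n) n → Bool
injectiveB σ = allB (λ r → allB (λ s → not (eqF (Vec.lookup σ r) (Vec.lookup σ s)) Data.Bool.∨ eqF r s))
  where import Data.Bool

iter : ∀ {n} → Vec (Fin n) n → ℕ → Fin n → Fin n
iter σ zero    x = x
iter σ (suc k) x = Vec.lookup σ (iter σ k x)

-- number of cycles of σ = number of vertices that are the least element of their orbit
cyclesB : ∀ {n} → Vec (Fin n) n → ℕ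
cyclesB {n} σ = countB (λ v → foldr (λ k b → (toℕ v ℕ.≤ᵇ toℕ (iter σ k v)) ∧ b) true (List.upTo n))

cycleCovers : ∀ {n} → (Fin n → Fin n → Bool) → List (Vec (Fin n) n)
cycleCovers {n} e = filter (λ σ → Data.Bool.T? (injectiveB σ ∧ allB (λ v → e v (Vec.lookup σ v)))) (allMaps n n)
  where import Data.Bool

sumℚ : List ℚ → ℚ
sumℚ = foldr ℚ._+_ 0ℚ

cycleCoverPoly : ∀ {n} → (Fin n → Fin n → Bool) → ℚ → ℚ
cycleCoverPoly e x = sumℚ (map (λ σ → pow x (cyclesB σ)) (cycleCovers e))

Γ : (W : Word) → Fin (nAnn W) → Fin (nAnn W) → Bool
Γ = edge

{-# OPTIONS --safe #-}
-- In a Dyck word the last annihilator L_i^* is immediately followed by its partner: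
-- W = A L_i^* L_j B with B made of creators. Pushing L_i^* through L_j B Ω with the defining
-- formula of L_N^* gives
--   ρ(W) = δ_ij ρ(A B) + N⁻¹ Σ_k δ(i, i_k) ρ(A B_k),
-- where B_k is B with its k-th letter recoloured to j. On the graph side, let v be the vertex of
-- that annihilator. A cycle cover of Γ(W) either has a loop at v, which exists iff i = j and
-- leaves a cycle cover of Γ(A B), or passes through u → v → s; shortcutting to u → s identifies
-- these covers with the cycle covers of Γ(A B_k), k the creator partnered with s. Since
-- N · N⁻¹ = 1, both sides of the theorem satisfy the same recursion. Recolouring destroys the
-- colourwise Dyck condition, so the induction on the length runs over words that are Dyck once
-- colours are forgotten.
module Submission where

open import Defs

module FiniteSums where

  open import Data.Nat as ℕ using (ℕ; zero; suc)
  open import Data.Rational using (ℚ; 0ℚ; _+_; _*_)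
  import Data.Rational.Properties as ℚ
  open import Data.Bool using (Bool; true; false; if_then_else_; T?)
  open import Data.List as List using (List; []; _∷_; _++_; [_]; map; concatMap; filter; allFin; tabulate; lookup)
  import Data.List.Properties as List
  open import Data.List.Membership.Propositional using (_∈_)
  open import Data.List.Relation.Unary.Any using (here; there)
  open import Data.Fin as Fin using (Fin; inject₁; fromℕ)
  open import Data.Vec as Vec using (Vec; _∷ʳ_)
  open import Relation.Binary.PropositionalEquality hiding ([_])
  open import Function using (_∘_; id)
  open import Level using (Level)
  open import Algebra.Bundles using (CommutativeMonoid)
  open import Algebra.Properties.CommutativeSemigroup (CommutativeMonoid.commutativeSemigroup ℚ.+-0-commutativeMonoid)
    using (interchange; xy∙z≈zy∙x)

  private
    variable
      a b : Level
      A : Set a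
      B : Set b

  ∑ : List A → (A → ℚ) → ℚ
  ∑ xs f = sumℚ (map f xs)

  syntax ∑ xs (λ x → e) = ∑[ x ∈ xs ] e

  ∑-++ : ∀ (xs ys : List A) f → ∑ (xs ++ ys) f ≡ ∑ xs f + ∑ ys f
  ∑-++ []       ys f = sym (ℚ.+-identityˡ _)
  ∑-++ (x ∷ xs) ys f = trans (cong (f x +_) (∑-++ xs ys f)) (sym (ℚ.+-assoc (f x) _ _))

  ∑-cong-∈ : ∀ (xs : List A) {f g : A → ℚ} → (∀ {x} → x ∈ xs → f x ≡ g x) → ∑ xs f ≡ ∑ xs g
  ∑-cong-∈ []       eq = refl
  ∑-cong-∈ (x ∷ xs) eq = cong₂ _+_ (eq (here refl)) (∑-cong-∈ xs (eq ∘ there))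

  ∑-cong : ∀ (xs : List A) {f g : A → ℚ} → (∀ x → f x ≡ g x) → ∑ xs f ≡ ∑ xs g
  ∑-cong xs eq = ∑-cong-∈ xs (λ {x} _ → eq x)

  ∑-zero : ∀ (xs : List A) → ∑[ x ∈ xs ] 0ℚ ≡ 0ℚ
  ∑-zero []       = refl
  ∑-zero (x ∷ xs) = trans (ℚ.+-identityˡ _) (∑-zero xs)

  ∑-+ : ∀ (xs : List A) f g → ∑[ x ∈ xs ] (f x + g x) ≡ ∑ xs f + ∑ xs g
  ∑-+ []       f g = refl
  ∑-+ (x ∷ xs) f g = trans (cong (f x + g x +_) (∑-+ xs f g)) (interchange (f x) (g x) _ _)

  *-distribˡ-∑ : ∀ c (xs : List A) f → ∑[ x ∈ xs ] (c * f x) ≡ c * ∑ xs f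
  *-distribˡ-∑ c []       f = sym (ℚ.*-zeroʳ c)
  *-distribˡ-∑ c (x ∷ xs) f = trans (cong (c * f x +_) (*-distribˡ-∑ c xs f)) (sym (ℚ.*-distribˡ-+ c (f x) _))

  ∑-filter : ∀ (P : A → Bool) (xs : List A) f →
    ∑ (filter (λ x → T? (P x)) xs) f ≡ ∑[ x ∈ xs ] (if P x then f x else 0ℚ)
  ∑-filter P []       f = refl
  ∑-filter P (x ∷ xs) f with P x
  ... | true  = cong (f x +_) (∑-filter P xs f)
  ... | false = trans (∑-filter P xs f) (sym (ℚ.+-identityˡ _))

  ∑-map : ∀ (g : A → B) (xs : List A) f → ∑ (map g xs) f ≡ ∑ xs (f ∘ g)
  ∑-map g xs f = cong sumℚ (sym (List.map-∘ {g = f} {f = g} xs))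

  ∑-concatMap : ∀ (g : A → List B) (xs : List A) f → ∑ (concatMap g xs) f ≡ ∑[ x ∈ xs ] ∑ (g x) f
  ∑-concatMap g []       f = refl
  ∑-concatMap g (x ∷ xs) f = trans (∑-++ (g x) (concatMap g xs) f) (cong (∑ (g x) f +_) (∑-concatMap g xs f))

  ∑-comm : ∀ (xs : List A) (ys : List B) (F : A → B → ℚ) →
    ∑[ x ∈ xs ] ∑[ y ∈ ys ] F x y ≡ ∑[ y ∈ ys ] ∑[ x ∈ xs ] F x y
  ∑-comm []       ys F = sym (∑-zero ys)
  ∑-comm (x ∷ xs) ys F = trans (cong (∑ ys (F x) +_) (∑-comm xs ys F)) (sym (∑-+ ys (F x) _))

  ∑-lookup : ∀ (xs : List A) f → ∑[ r ∈ allFin (List.length xs) ] f (lookup xs r) ≡ ∑ xs f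
  ∑-lookup xs f = begin
    ∑ (allFin _) (f ∘ lookup xs)       ≡⟨ sym (∑-map (lookup xs) (allFin _) f) ⟩
    ∑ (map (lookup xs) (allFin _)) f   ≡⟨ cong (λ ys → ∑ ys f) (List.map-tabulate id (lookup xs)) ⟩
    ∑ (tabulate (lookup xs)) f         ≡⟨ cong (λ ys → ∑ ys f) (List.tabulate-lookup xs) ⟩
    ∑ xs f                             ∎
    where open ≡-Reasoning

  ∑-allFin-suc : ∀ n f → ∑ (allFin (suc n)) f ≡ f Fin.zero + ∑[ x ∈ allFin n ] f (Fin.suc x)
  ∑-allFin-suc n f = cong (f Fin.zero +_) (begin
    ∑ (tabulate Fin.suc) f          ≡⟨ cong (λ ys → ∑ ys f) (sym (List.map-tabulate id Fin.suc)) ⟩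
    ∑ (map Fin.suc (allFin n)) f    ≡⟨ ∑-map Fin.suc (allFin n) f ⟩
    ∑ (allFin n) (f ∘ Fin.suc)      ∎)
    where open ≡-Reasoning

  tabulate-∷ʳ : ∀ {n} (f : Fin (suc n) → A) → tabulate f ≡ tabulate (f ∘ inject₁) ++ [ f (fromℕ n) ]
  tabulate-∷ʳ {n = zero}  f = refl
  tabulate-∷ʳ {n = suc n} f = cong (f Fin.zero ∷_) (tabulate-∷ʳ (f ∘ Fin.suc))

  allFin-∷ʳ : ∀ n → allFin (suc n) ≡ map inject₁ (allFin n) ++ [ fromℕ n ]
  allFin-∷ʳ n = trans (tabulate-∷ʳ id) (cong (_++ [ fromℕ n ]) (sym (List.map-tabulate id inject₁)))

  ∑-allFin-last : ∀ n f → ∑ (allFin (suc n)) f ≡ ∑[ x ∈ allFin n ] f (inject₁ x) + f (fromℕ n)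
  ∑-allFin-last n f = begin
    ∑ (allFin (suc n)) f                                       ≡⟨ cong (λ xs → ∑ xs f) (allFin-∷ʳ n) ⟩
    ∑ (map inject₁ (allFin n) ++ [ fromℕ n ]) f                ≡⟨ ∑-++ (map inject₁ (allFin n)) [ fromℕ n ] f ⟩
    ∑ (map inject₁ (allFin n)) f + (f (fromℕ n) + 0ℚ)          ≡⟨ cong₂ _+_ (∑-map inject₁ (allFin n) f) (ℚ.+-identityʳ _) ⟩
    ∑ (allFin n) (f ∘ inject₁) + f (fromℕ n)                   ∎
    where open ≡-Reasoning

  ∑-update : ∀ n (s : Fin n) a f →
    ∑[ y ∈ allFin n ] (if eqF y s then a else f y) + f s ≡ ∑ (allFin n) f + a
  ∑-update (suc n) Fin.zero a f = begin
    ∑ (allFin (suc n)) g + f Fin.zero                   ≡⟨ cong (_+ f Fin.zero) (∑-allFin-suc n g) ⟩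
    (a + ∑ (allFin n) (f ∘ Fin.suc)) + f Fin.zero       ≡⟨ xy∙z≈zy∙x a _ (f Fin.zero) ⟩
    (f Fin.zero + ∑ (allFin n) (f ∘ Fin.suc)) + a       ≡⟨ cong (_+ a) (sym (∑-allFin-suc n f)) ⟩
    ∑ (allFin (suc n)) f + a                            ∎
    where
    open ≡-Reasoning
    g : Fin (suc n) → ℚ
    g y = if eqF y Fin.zero then a else f y
  ∑-update (suc n) (Fin.suc s) a f = begin
    ∑ (allFin (suc n)) g + f (Fin.suc s)                           ≡⟨ cong (_+ f (Fin.suc s)) (∑-allFin-suc n g) ⟩
    (f Fin.zero + ∑ (allFin n) (g ∘ Fin.suc)) + f (Fin.suc s)      ≡⟨ ℚ.+-assoc (f Fin.zero) _ _ ⟩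
    f Fin.zero + (∑ (allFin n) (g ∘ Fin.suc) + f (Fin.suc s))      ≡⟨ cong (f Fin.zero +_) (∑-update n s a (f ∘ Fin.suc)) ⟩
    f Fin.zero + (∑ (allFin n) (f ∘ Fin.suc) + a)                  ≡⟨ sym (ℚ.+-assoc (f Fin.zero) _ _) ⟩
    (f Fin.zero + ∑ (allFin n) (f ∘ Fin.suc)) + a                  ≡⟨ cong (_+ a) (sym (∑-allFin-suc n f)) ⟩
    ∑ (allFin (suc n)) f + a                                       ∎
    where
    open ≡-Reasoning
    g : Fin (suc n) → ℚ
    g y = if eqF y (Fin.suc s) then a else f y

  ∑-allMaps-zero : ∀ m f → ∑ (allMaps m 0) f ≡ f Vec.[]
  ∑-allMaps-zero m f = ℚ.+-identityʳ (f Vec.[])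

  ∑-allMaps-suc : ∀ m k f → ∑ (allMaps m (suc k)) f ≡ ∑[ x ∈ allFin m ] ∑[ v ∈ allMaps m k ] f (x Vec.∷ v)
  ∑-allMaps-suc m k f = trans (∑-concatMap (λ x → map (x Vec.∷_) (allMaps m k)) (allFin m) f)
    (∑-cong (allFin m) (λ x → ∑-map (x Vec.∷_) (allMaps m k) f))

  ∑-allMaps-∷ʳ : ∀ m k f → ∑ (allMaps m (suc k)) f ≡ ∑[ v ∈ allMaps m k ] ∑[ x ∈ allFin m ] f (v ∷ʳ x)
  ∑-allMaps-∷ʳ m zero f = trans (∑-allMaps-suc m zero f) (trans
    (∑-cong (allFin m) (λ x → ∑-allMaps-zero m (λ v → f (x Vec.∷ v))))
    (sym (∑-allMaps-zero m (λ v → ∑ (allFin m) (λ x → f (v ∷ʳ x))))))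
  ∑-allMaps-∷ʳ m (suc k) f = begin
    ∑ (allMaps m (suc (suc k))) f                                                    ≡⟨ ∑-allMaps-suc m (suc k) f ⟩
    ∑[ x ∈ allFin m ] ∑[ v ∈ allMaps m (suc k) ] f (x Vec.∷ v)                         ≡⟨ ∑-cong (allFin m) (λ x → ∑-allMaps-∷ʳ m k (λ v → f (x Vec.∷ v))) ⟩
    ∑[ x ∈ allFin m ] ∑[ v ∈ allMaps m k ] ∑[ y ∈ allFin m ] f (x Vec.∷ (v ∷ʳ y))      ≡⟨ sym (∑-allMaps-suc m k _) ⟩
    ∑[ v ∈ allMaps m (suc k) ] ∑[ y ∈ allFin m ] f (v ∷ʳ y)                            ∎
    where open ≡-Reasoning

  ∑-allMaps-avoiding : ∀ n (y : Fin (suc n)) (ρ : Fin n → Fin (suc n)) →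
    (∀ h → ∑ (allFin (suc n)) h ≡ h y + ∑[ z ∈ allFin n ] h (ρ z)) →
    ∀ k (g : Vec (Fin (suc n)) k → ℚ) → (∀ τ r → Vec.lookup τ r ≡ y → g τ ≡ 0ℚ) →
    ∑ (allMaps (suc n) k) g ≡ ∑[ τ ∈ allMaps n k ] g (Vec.map ρ τ)
  ∑-allMaps-avoiding n y ρ split zero    g vanish =
    trans (∑-allMaps-zero (suc n) g) (sym (∑-allMaps-zero n (g ∘ Vec.map ρ)))
  ∑-allMaps-avoiding n y ρ split (suc k) g vanish = begin
    ∑ (allMaps (suc n) (suc k)) g                              ≡⟨ ∑-allMaps-suc (suc n) k g ⟩
    ∑ (allFin (suc n)) H                                       ≡⟨ split H ⟩
    H y + ∑ (allFin n) (H ∘ ρ)                                 ≡⟨ cong (_+ ∑ (allFin n) (H ∘ ρ)) H[y]≡0 ⟩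
    0ℚ + ∑ (allFin n) (H ∘ ρ)                                  ≡⟨ ℚ.+-identityˡ _ ⟩
    ∑ (allFin n) (H ∘ ρ)                                       ≡⟨ ∑-cong (allFin n) (λ z → ∑-allMaps-avoiding n y ρ split k _
                                                                     (λ τ r → vanish (ρ z Vec.∷ τ) (Fin.suc r))) ⟩
    ∑[ z ∈ allFin n ] ∑[ τ ∈ allMaps n k ] g (ρ z Vec.∷ Vec.map ρ τ) ≡⟨ sym (∑-allMaps-suc n k (g ∘ Vec.map ρ)) ⟩
    ∑[ τ ∈ allMaps n (suc k) ] g (Vec.map ρ τ)                 ∎
    where
    open ≡-Reasoning
    H : Fin (suc n) → ℚ
    H z = ∑[ τ ∈ allMaps (suc n) k ] g (z Vec.∷ τ)
    H[y]≡0 : H y ≡ 0ℚ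
    H[y]≡0 = trans (∑-cong (allMaps (suc n) k) (λ τ → vanish (y Vec.∷ τ) Fin.zero refl)) (∑-zero (allMaps (suc n) k))

  ∑< : ℕ → (ℕ → ℚ) → ℚ
  ∑< zero    f = 0ℚ
  ∑< (suc n) f = f 0 + ∑< n (f ∘ suc)

  syntax ∑< n (λ k → e) = ∑[ k < n ] e

  ∑<-cong : ∀ n {f g : ℕ → ℚ} → (∀ k → k ℕ.< n → f k ≡ g k) → ∑< n f ≡ ∑< n g
  ∑<-cong zero    eq = refl
  ∑<-cong (suc n) eq = cong₂ _+_ (eq 0 (ℕ.s≤s ℕ.z≤n)) (∑<-cong n (λ k k<n → eq (suc k) (ℕ.s≤s k<n)))

  *-distribˡ-∑< : ∀ n c f → ∑[ k < n ] (c * f k) ≡ c * ∑< n f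
  *-distribˡ-∑< zero    c f = sym (ℚ.*-zeroʳ c)
  *-distribˡ-∑< (suc n) c f = trans (cong (c * f 0 +_) (*-distribˡ-∑< n c (f ∘ suc))) (sym (ℚ.*-distribˡ-+ c (f 0) _))

module CycleCovers where

  open import Data.Nat as ℕ using (ℕ; zero; suc; _≤_; _<_; _∸_; _≤ᵇ_)
  import Data.Nat.Properties as ℕ
  open import Data.Nat.DivMod using (_%_; _/_; m≡m%n+[m/n]*n; m%n<n)
  open import Data.Bool using (Bool; true; false; if_then_else_; _∧_; _∨_; not; T; T?)
  open import Data.Rational using (ℚ; 0ℚ; 1ℚ; _+_; _*_)
  import Data.Rational.Properties as ℚ
  import Data.Bool.Properties as Bool
  open import Data.List as List using (List; []; _∷_; _++_; [_]; foldr; upTo; filter; map; length; allFin)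
  import Data.List.Properties as List
  open import Data.List.Membership.Propositional using (_∈_)
  open import Data.List.Membership.Propositional.Properties using (∈-upTo⁺; ∈-allFin; ∈-lookup)
  open import Data.List.Relation.Unary.Any using (here; there)
  open import Data.Fin as Fin using (Fin; toℕ; inject₁; fromℕ)
  import Data.Fin.Properties as Fin
  open import Data.Vec as Vec using (Vec; lookup; _∷ʳ_)
  import Data.Vec.Properties as Vec
  open import Data.Product using (∃; _×_; _,_; proj₁)
  open import Data.Sum as Sum using (_⊎_; inj₁; inj₂)
  open import Data.Empty using (⊥-elim)
  open import Function using (_∘_; _⇔_; mk⇔; Equivalence)
  open import Function.Definitions using (Injective)
  open import Relation.Binary.PropositionalEquality hiding ([_])
  open import Relation.Nullary.Decidable using (dec-true)
  open import Level using (Level)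
  open FiniteSums

  private
    variable
      a b : Level
      A : Set a
      B : Set b
      n : ℕ

  ≡-from-≡true : ∀ {x y : Bool} → (x ≡ true → y ≡ true) → (y ≡ true → x ≡ true) → x ≡ y
  ≡-from-≡true {true}  {true}  _ _ = refl
  ≡-from-≡true {true}  {false} f _ = sym (f refl)
  ≡-from-≡true {false} {true}  _ g = g refl
  ≡-from-≡true {false} {false} _ _ = refl

  ≡true⇒T : ∀ {x} → x ≡ true → T x
  ≡true⇒T = Equivalence.from Bool.T-≡

  T⇒≡true : ∀ {x} → T x → x ≡ true
  T⇒≡true = Equivalence.to Bool.T-≡

  foldr-∧-true⁻ : ∀ (f : A → Bool) xs → foldr (λ x b → f x ∧ b) true xs ≡ true → ∀ {x} → x ∈ xs → f x ≡ true
  foldr-∧-true⁻ f (y ∷ xs) h (here refl) = Bool.∧-conicalˡ (f y) _ h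
  foldr-∧-true⁻ f (y ∷ xs) h (there x∈) = foldr-∧-true⁻ f xs (Bool.∧-conicalʳ (f y) _ h) x∈

  foldr-∧-true⁺ : ∀ (f : A → Bool) xs → (∀ {x} → x ∈ xs → f x ≡ true) → foldr (λ x b → f x ∧ b) true xs ≡ true
  foldr-∧-true⁺ f []       h = refl
  foldr-∧-true⁺ f (y ∷ xs) h rewrite h (here refl) = foldr-∧-true⁺ f xs (h ∘ there)

  allB-true⁻ : ∀ (f : Fin n → Bool) → allB f ≡ true → ∀ x → f x ≡ true
  allB-true⁻ {n} f h x = foldr-∧-true⁻ f (allFin n) h (∈-allFin x)

  allB-true⁺ : ∀ (f : Fin n → Bool) → (∀ x → f x ≡ true) → allB f ≡ true
  allB-true⁺ {n} f h = foldr-∧-true⁺ f (allFin n) (λ {x} _ → h x)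

  eqF⇒≡ : ∀ {x y : Fin n} → eqF x y ≡ true → x ≡ y
  eqF⇒≡ {x = x} {y} h = Fin.toℕ-injective (ℕ.≡ᵇ⇒≡ (toℕ x) (toℕ y) (≡true⇒T h))

  -- does (m ℕ.≟ n), does (m ℕ.<? n), does (m ℕ.≤? n) reduce to m ≡ᵇ n, m <ᵇ n, m ≤ᵇ n,
  -- so dec-true and dec-false evaluate boolean comparisons here and below.
  eqF-refl : ∀ (x : Fin n) → eqF x x ≡ true
  eqF-refl x = dec-true (toℕ x ℕ.≟ toℕ x) refl

  length-filter-map : ∀ (f : B → Bool) (g : A → B) xs →
    length (filter (λ y → T? (f y)) (map g xs)) ≡ length (filter (λ x → T? (f (g x))) xs)
  length-filter-map f g []       = refl
  length-filter-map f g (x ∷ xs) with f (g x)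
  ... | true  = cong suc (length-filter-map f g xs)
  ... | false = length-filter-map f g xs

  countB-cong : ∀ {f g : Fin n → Bool} → (∀ x → f x ≡ g x) → countB f ≡ countB g
  countB-cong {n} {f} {g} eq = cong length (List.filter-≐ (λ x → T? (f x)) (λ x → T? (g x))
    ((λ {x} → subst T (eq x)) , (λ {x} → subst T (sym (eq x)))) (allFin n))

  countB-last : ∀ (f : Fin (suc n) → Bool) → countB f ≡ countB (f ∘ inject₁) ℕ.+ (if f (fromℕ n) then 1 else 0)
  countB-last {n} f = begin
    countB f                                                          ≡⟨ cong (length ∘ filter P?) (allFin-∷ʳ n) ⟩
    length (filter P? (map inject₁ (allFin n) ++ [ fromℕ n ]))        ≡⟨ cong length (List.filter-++ P? (map inject₁ (allFin n)) _) ⟩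
    length (filter P? (map inject₁ (allFin n)) ++ filter P? [ fromℕ n ]) ≡⟨ List.length-++ (filter P? (map inject₁ (allFin n))) ⟩
    length (filter P? (map inject₁ (allFin n))) ℕ.+ length (filter P? [ fromℕ n ])
      ≡⟨ cong₂ ℕ._+_ (length-filter-map f inject₁ (allFin n)) last ⟩
    countB (f ∘ inject₁) ℕ.+ (if f (fromℕ n) then 1 else 0)          ∎
    where
    open ≡-Reasoning
    P? = λ x → T? (f x)
    last : length (filter P? [ fromℕ n ]) ≡ (if f (fromℕ n) then 1 else 0)
    last with f (fromℕ n)
    ... | true  = refl
    ... | false = refl

  injectiveB-true⁻ : ∀ (σ : Vec (Fin n) n) → injectiveB σ ≡ true → Injective _≡_ _≡_ (lookup σ)
  injectiveB-true⁻ σ h {r} {s} σr≡σs =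
    eqF⇒≡ (subst (λ b → not b ∨ eqF r s ≡ true) eq (allB-true⁻ _ (allB-true⁻ _ h r) s))
    where
    eq : eqF (lookup σ r) (lookup σ s) ≡ true
    eq = subst (λ y → eqF y (lookup σ s) ≡ true) (sym σr≡σs) (eqF-refl (lookup σ s))

  injectiveB-true⁺ : ∀ (σ : Vec (Fin n) n) → Injective _≡_ _≡_ (lookup σ) → injectiveB σ ≡ true
  injectiveB-true⁺ σ inj = allB-true⁺ _ (λ r → allB-true⁺ _ (λ s → pair r s))
    where
    pair : ∀ r s → not (eqF (lookup σ r) (lookup σ s)) ∨ eqF r s ≡ true
    pair r s with eqF (lookup σ r) (lookup σ s) in eq
    ... | false = refl
    ... | true  rewrite inj (eqF⇒≡ eq) = eqF-refl s

  module _ (σ : Vec (Fin n) n) where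

    iter-+ : ∀ k l x → iter σ (k ℕ.+ l) x ≡ iter σ k (iter σ l x)
    iter-+ zero    l x = refl
    iter-+ (suc k) l x = cong (lookup σ) (iter-+ k l x)

    iter-cancel : Injective _≡_ _≡_ (lookup σ) → ∀ k d v → iter σ k v ≡ iter σ (k ℕ.+ d) v → v ≡ iter σ d v
    iter-cancel inj zero    d v eq = eq
    iter-cancel inj (suc k) d v eq = iter-cancel inj k d v (inj eq)

    iter-periodic : ∀ d v → v ≡ iter σ d v → ∀ q r → iter σ (r ℕ.+ q ℕ.* d) v ≡ iter σ r v
    iter-periodic d v per zero    r = cong (λ k → iter σ k v) (ℕ.+-identityʳ r)
    iter-periodic d v per (suc q) r = begin
      iter σ (r ℕ.+ (d ℕ.+ q ℕ.* d)) v    ≡⟨ cong (λ k → iter σ k v) (x∙yz≈xz∙y r d (q ℕ.* d)) ⟩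
      iter σ ((r ℕ.+ q ℕ.* d) ℕ.+ d) v    ≡⟨ iter-+ (r ℕ.+ q ℕ.* d) d v ⟩
      iter σ (r ℕ.+ q ℕ.* d) (iter σ d v) ≡⟨ cong (iter σ (r ℕ.+ q ℕ.* d)) (sym per) ⟩
      iter σ (r ℕ.+ q ℕ.* d) v            ≡⟨ iter-periodic d v per q r ⟩
      iter σ r v                          ∎
      where
      open ≡-Reasoning
      open import Algebra.Properties.CommutativeSemigroup ℕ.+-commutativeSemigroup using (x∙yz≈xz∙y)

    -- Pigeonhole gives i < j ≤ n with σ^i v = σ^j v; injectivity makes j - i a period of v.
    iter-reduce : Injective _≡_ _≡_ (lookup σ) → ∀ v k → ∃ λ k′ → k′ < n × iter σ k v ≡ iter σ k′ v
    iter-reduce inj v k with Fin.pigeonhole (ℕ.n<1+n n) (λ i → iter σ (toℕ i) v)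
    ... | i , j , i<j , σⁱv≡σʲv = k % d , ℕ.<-≤-trans (m%n<n k d) d≤n , reduce
      where
      d = toℕ j ∸ toℕ i
      instance
        d≢0 : ℕ.NonZero d
        d≢0 = ℕ.>-nonZero (ℕ.m<n⇒0<n∸m i<j)
      d≤n : d ≤ n
      d≤n = ℕ.≤-trans (ℕ.m∸n≤m (toℕ j) (toℕ i)) (ℕ.≤-pred (Fin.toℕ<n j))
      period : v ≡ iter σ d v
      period = iter-cancel inj (toℕ i) d v
        (trans σⁱv≡σʲv (cong (λ k → iter σ k v) (sym (ℕ.m+[n∸m]≡n (ℕ.<⇒≤ i<j)))))
      reduce : iter σ k v ≡ iter σ (k % d) v
      reduce = trans (cong (λ k → iter σ k v) (m≡m%n+[m/n]*n k d)) (iter-periodic d v period (k / d) (k % d))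

    -- Verbatim the predicate counted by cyclesB.
    isOrbitMin : Fin n → Bool
    isOrbitMin v = foldr (λ k b → (toℕ v ≤ᵇ toℕ (iter σ k v)) ∧ b) true (upTo n)

    OrbitMin : Fin n → Set
    OrbitMin v = ∀ k → toℕ v ≤ toℕ (iter σ k v)

    isOrbitMin-true⁻ : Injective _≡_ _≡_ (lookup σ) → ∀ v → isOrbitMin v ≡ true → OrbitMin v
    isOrbitMin-true⁻ inj v h k with iter-reduce inj v k
    ... | k′ , k′<n , eq rewrite eq =
      ℕ.≤ᵇ⇒≤ (toℕ v) _ (≡true⇒T (foldr-∧-true⁻ (λ k → toℕ v ≤ᵇ toℕ (iter σ k v)) (upTo n) h (∈-upTo⁺ k′<n)))

    isOrbitMin-true⁺ : ∀ v → OrbitMin v → isOrbitMin v ≡ true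
    isOrbitMin-true⁺ v h = foldr-∧-true⁺ _ (upTo n) (λ {k} _ → T⇒≡true (ℕ.≤⇒≤ᵇ (h k)))

  isOrbitMin-cong : ∀ {m} (σ : Vec (Fin m) m) (τ : Vec (Fin n) n) →
    Injective _≡_ _≡_ (lookup σ) → Injective _≡_ _≡_ (lookup τ) →
    ∀ v w → OrbitMin σ v ⇔ OrbitMin τ w → isOrbitMin σ v ≡ isOrbitMin τ w
  isOrbitMin-cong σ τ σ-inj τ-inj v w v⇔w = ≡-from-≡true
    (λ h → isOrbitMin-true⁺ τ w (Equivalence.to v⇔w (isOrbitMin-true⁻ σ σ-inj v h)))
    (λ h → isOrbitMin-true⁺ σ v (Equivalence.from v⇔w (isOrbitMin-true⁻ τ τ-inj w h)))

  inject₁-or-fromℕ : ∀ (v : Fin (suc n)) → (∃ λ r → v ≡ inject₁ r) ⊎ v ≡ fromℕ n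
  inject₁-or-fromℕ {zero}  Fin.zero    = inj₂ refl
  inject₁-or-fromℕ {suc n} Fin.zero    = inj₁ (Fin.zero , refl)
  inject₁-or-fromℕ {suc n} (Fin.suc v) with inject₁-or-fromℕ v
  ... | inj₁ (r , refl) = inj₁ (Fin.suc r , refl)
  ... | inj₂ refl       = inj₂ refl

  lookup-∷ʳ-inject₁ : ∀ (xs : Vec A n) x r → lookup (xs ∷ʳ x) (inject₁ r) ≡ lookup xs r
  lookup-∷ʳ-inject₁ (y Vec.∷ xs) x Fin.zero    = refl
  lookup-∷ʳ-inject₁ (y Vec.∷ xs) x (Fin.suc r) = lookup-∷ʳ-inject₁ xs x r

  lookup-∷ʳ-fromℕ : ∀ (xs : Vec A n) x → lookup (xs ∷ʳ x) (fromℕ n) ≡ x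
  lookup-∷ʳ-fromℕ Vec.[]       x = refl
  lookup-∷ʳ-fromℕ (y Vec.∷ xs) x = lookup-∷ʳ-fromℕ xs x

  isCycleCover : (Fin n → Fin n → Bool) → Vec (Fin n) n → Bool
  isCycleCover e σ = injectiveB σ ∧ allB (λ v → e v (lookup σ v))

  extend : (Fin n → Fin (suc n)) → Fin (suc n) → Vec (Fin n) n → Vec (Fin (suc n)) (suc n)
  extend ρ y τ = Vec.map ρ τ ∷ʳ y

  module Extend {n} (ρ : Fin n → Fin (suc n)) (y : Fin (suc n))
                (ρ-injective : Injective _≡_ _≡_ ρ) (ρ≢y : ∀ z → ρ z ≢ y) where

    lookup-extend-inject₁ : ∀ τ r → lookup (extend ρ y τ) (inject₁ r) ≡ ρ (lookup τ r)
    lookup-extend-inject₁ τ r = trans (lookup-∷ʳ-inject₁ (Vec.map ρ τ) y r) (Vec.lookup-map r ρ τ)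

    lookup-extend-fromℕ : ∀ τ → lookup (extend ρ y τ) (fromℕ n) ≡ y
    lookup-extend-fromℕ τ = lookup-∷ʳ-fromℕ (Vec.map ρ τ) y

    extend-injective⁻ : ∀ τ → Injective _≡_ _≡_ (lookup (extend ρ y τ)) → Injective _≡_ _≡_ (lookup τ)
    extend-injective⁻ τ inj {r} {s} eq = Fin.inject₁-injective (inj
      (trans (lookup-extend-inject₁ τ r) (trans (cong ρ eq) (sym (lookup-extend-inject₁ τ s)))))

    extend-injective⁺ : ∀ τ → Injective _≡_ _≡_ (lookup τ) → Injective _≡_ _≡_ (lookup (extend ρ y τ))
    extend-injective⁺ τ inj {u} {v} eq with inject₁-or-fromℕ u | inject₁-or-fromℕ v
    ... | inj₁ (r , refl) | inj₁ (s , refl) = cong inject₁ (inj (ρ-injective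
      (trans (sym (lookup-extend-inject₁ τ r)) (trans eq (lookup-extend-inject₁ τ s)))))
    ... | inj₁ (r , refl) | inj₂ refl = ⊥-elim (ρ≢y _
      (trans (sym (lookup-extend-inject₁ τ r)) (trans eq (lookup-extend-fromℕ τ))))
    ... | inj₂ refl | inj₁ (s , refl) = ⊥-elim (ρ≢y _
      (trans (sym (lookup-extend-inject₁ τ s)) (trans (sym eq) (lookup-extend-fromℕ τ))))
    ... | inj₂ refl | inj₂ refl = refl

    injectiveB-extend : ∀ τ → injectiveB (extend ρ y τ) ≡ injectiveB τ
    injectiveB-extend τ = ≡-from-≡true
      (λ h → injectiveB-true⁺ τ (extend-injective⁻ τ (injectiveB-true⁻ (extend ρ y τ) h)))
      (λ h → injectiveB-true⁺ (extend ρ y τ) (extend-injective⁺ τ (injectiveB-true⁻ τ h)))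

    module _ (e : Fin (suc n) → Fin (suc n) → Bool) (e′ : Fin n → Fin n → Bool)
             (e′≡e : ∀ r z → e′ r z ≡ e (inject₁ r) (ρ z)) where

      edges-extend : ∀ τ → allB (λ v → e v (lookup (extend ρ y τ) v)) ≡ e (fromℕ n) y ∧ allB (λ r → e′ r (lookup τ r))
      edges-extend τ = ≡-from-≡true to from
        where
        to : allB (λ v → e v (lookup (extend ρ y τ) v)) ≡ true → e (fromℕ n) y ∧ allB (λ r → e′ r (lookup τ r)) ≡ true
        to h rewrite subst (λ z → e (fromℕ n) z ≡ true) (lookup-extend-fromℕ τ) (allB-true⁻ _ h (fromℕ n)) =
          allB-true⁺ _ (λ r → trans (e′≡e r (lookup τ r))
            (subst (λ z → e (inject₁ r) z ≡ true) (lookup-extend-inject₁ τ r) (allB-true⁻ _ h (inject₁ r))))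
        from : e (fromℕ n) y ∧ allB (λ r → e′ r (lookup τ r)) ≡ true → allB (λ v → e v (lookup (extend ρ y τ) v)) ≡ true
        from h = allB-true⁺ _ follows
          where
          follows : ∀ v → e v (lookup (extend ρ y τ) v) ≡ true
          follows v with inject₁-or-fromℕ v
          ... | inj₁ (r , refl) rewrite lookup-extend-inject₁ τ r =
            trans (sym (e′≡e r (lookup τ r))) (allB-true⁻ _ (Bool.∧-conicalʳ _ _ h) r)
          ... | inj₂ refl rewrite lookup-extend-fromℕ τ = Bool.∧-conicalˡ _ _ h

      isCycleCover-extend : ∀ τ → isCycleCover e (extend ρ y τ) ≡ e (fromℕ n) y ∧ isCycleCover e′ τ
      isCycleCover-extend τ = trans (cong₂ _∧_ (injectiveB-extend τ) (edges-extend τ))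
                                    (∧-exchange (injectiveB τ) (e (fromℕ n) y) _)
        where
        ∧-exchange : ∀ a b c → a ∧ (b ∧ c) ≡ b ∧ (a ∧ c)
        ∧-exchange true  b c = refl
        ∧-exchange false b c = sym (Bool.∧-zeroʳ b)

  cyclesB-via-last : ∀ (σ : Vec (Fin (suc n)) (suc n)) (τ : Vec (Fin n) n) →
    Injective _≡_ _≡_ (lookup σ) → Injective _≡_ _≡_ (lookup τ) →
    (∀ v → OrbitMin σ (inject₁ v) ⇔ OrbitMin τ v) →
    cyclesB σ ≡ cyclesB τ ℕ.+ (if isOrbitMin σ (fromℕ n) then 1 else 0)
  cyclesB-via-last σ τ σ-inj τ-inj orbits = trans (countB-last (isOrbitMin σ))
    (cong (ℕ._+ _) (countB-cong (λ v → isOrbitMin-cong σ τ σ-inj τ-inj (inject₁ v) v (orbits v))))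

  OrbitMin-inject₁ : ∀ (σ : Vec (Fin (suc n)) (suc n)) (τ : Vec (Fin n) n) v →
    (∀ k → ∃ λ k′ → iter σ k′ (inject₁ v) ≡ inject₁ (iter τ k v)) →
    (∀ k′ → iter σ k′ (inject₁ v) ≡ fromℕ n ⊎ ∃ λ k → iter σ k′ (inject₁ v) ≡ inject₁ (iter τ k v)) →
    OrbitMin σ (inject₁ v) ⇔ OrbitMin τ v
  OrbitMin-inject₁ {n} σ τ v τ⊆σ σ⊆τ = mk⇔ to from
    where
    to : OrbitMin σ (inject₁ v) → OrbitMin τ v
    to min k with τ⊆σ k
    ... | k′ , eq = subst₂ _≤_ (Fin.toℕ-inject₁ v) (trans (cong toℕ eq) (Fin.toℕ-inject₁ _)) (min k′)
    from : OrbitMin τ v → OrbitMin σ (inject₁ v)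
    from min k′ with σ⊆τ k′
    ... | inj₁ eq = subst₂ _≤_ (sym (Fin.toℕ-inject₁ v)) (sym (trans (cong toℕ eq) (Fin.toℕ-fromℕ n)))
                      (ℕ.<⇒≤ (Fin.toℕ<n v))
    ... | inj₂ (k , eq) = subst₂ _≤_ (sym (Fin.toℕ-inject₁ v)) (sym (trans (cong toℕ eq) (Fin.toℕ-inject₁ _))) (min k)

  withLoop : Vec (Fin n) n → Vec (Fin (suc n)) (suc n)
  withLoop {n} = extend inject₁ (fromℕ n)

  module WithLoop {n} (τ : Vec (Fin n) n) where

    open Extend inject₁ (fromℕ n) Fin.inject₁-injective (λ r eq → Fin.fromℕ≢inject₁ (sym eq)) public

    iter-inject₁ : ∀ k v → iter (withLoop τ) k (inject₁ v) ≡ inject₁ (iter τ k v)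
    iter-inject₁ zero    v = refl
    iter-inject₁ (suc k) v rewrite iter-inject₁ k v = lookup-extend-inject₁ τ (iter τ k v)

    iter-fromℕ : ∀ k → iter (withLoop τ) k (fromℕ n) ≡ fromℕ n
    iter-fromℕ zero    = refl
    iter-fromℕ (suc k) rewrite iter-fromℕ k = lookup-extend-fromℕ τ

    cyclesB-withLoop : Injective _≡_ _≡_ (lookup τ) → cyclesB (withLoop τ) ≡ suc (cyclesB τ)
    cyclesB-withLoop τ-inj = begin
      cyclesB (withLoop τ)                                                        ≡⟨ cyclesB-via-last (withLoop τ) τ
                                                                                       (extend-injective⁺ τ τ-inj) τ-inj orbits ⟩
      cyclesB τ ℕ.+ (if isOrbitMin (withLoop τ) (fromℕ n) then 1 else 0)          ≡⟨ cong (λ b → cyclesB τ ℕ.+ (if b then 1 else 0))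
                                                                                       (isOrbitMin-true⁺ (withLoop τ) (fromℕ n) last-min) ⟩
      cyclesB τ ℕ.+ 1                                                             ≡⟨ ℕ.+-comm (cyclesB τ) 1 ⟩
      suc (cyclesB τ)                                                             ∎
      where
      open ≡-Reasoning
      orbits : ∀ v → OrbitMin (withLoop τ) (inject₁ v) ⇔ OrbitMin τ v
      orbits v = OrbitMin-inject₁ (withLoop τ) τ v (λ k → k , iter-inject₁ k v) (λ k → inj₂ (k , iter-inject₁ k v))
      last-min : OrbitMin (withLoop τ) (fromℕ n)
      last-min k rewrite iter-fromℕ k = ℕ.≤-refl

  redirect : Fin n → Fin n → Fin (suc n)
  redirect {n} s z = if eqF z s then fromℕ n else inject₁ z

  -- The last vertex is spliced into the cycle of τ just before s.
  insertBefore : Fin n → Vec (Fin n) n → Vec (Fin (suc n)) (suc n)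
  insertBefore s = extend (redirect s) (inject₁ s)

  module InsertBefore {n} (s : Fin n) (τ : Vec (Fin n) n) where

    redirect-injective : Injective _≡_ _≡_ (redirect s)
    redirect-injective {a} {b} eq with eqF a s in ea | eqF b s in eb
    ... | true  | true  = trans (eqF⇒≡ ea) (sym (eqF⇒≡ eb))
    ... | true  | false = ⊥-elim (Fin.fromℕ≢inject₁ eq)
    ... | false | true  = ⊥-elim (Fin.fromℕ≢inject₁ (sym eq))
    ... | false | false = Fin.inject₁-injective eq

    redirect≢inject₁ : ∀ z → redirect s z ≢ inject₁ s
    redirect≢inject₁ z eq with eqF z s in ez
    ... | true  = Fin.fromℕ≢inject₁ eq
    ... | false with Fin.inject₁-injective eq
    ...   | refl with () ← trans (sym (eqF-refl z)) ez

    open Extend (redirect s) (inject₁ s) redirect-injective redirect≢inject₁ public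

    lookup-inject₁ : ∀ r → lookup (insertBefore s τ) (inject₁ r) ≡ redirect s (lookup τ r)
    lookup-inject₁ = lookup-extend-inject₁ τ

    lookup-fromℕ : lookup (insertBefore s τ) (fromℕ n) ≡ inject₁ s
    lookup-fromℕ = lookup-extend-fromℕ τ

    step-inject₁ : ∀ z → eqF (lookup τ z) s ≡ false → lookup (insertBefore s τ) (inject₁ z) ≡ inject₁ (lookup τ z)
    step-inject₁ z ne rewrite lookup-inject₁ z | ne = refl

    step-fromℕ : ∀ z → eqF (lookup τ z) s ≡ true → lookup (insertBefore s τ) (inject₁ z) ≡ fromℕ n
    step-fromℕ z eq rewrite lookup-inject₁ z | eq = refl

    τ-orbit⊆σ-orbit : ∀ v k → ∃ λ k′ → iter (insertBefore s τ) k′ (inject₁ v) ≡ inject₁ (iter τ k v)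
    τ-orbit⊆σ-orbit v zero = zero , refl
    τ-orbit⊆σ-orbit v (suc k) with τ-orbit⊆σ-orbit v k
    ... | k′ , h with eqF (lookup τ (iter τ k v)) s in eq
    ... | false = suc k′ , trans (cong (lookup (insertBefore s τ)) h) (step-inject₁ (iter τ k v) eq)
    ... | true  = suc (suc k′) , trans (cong (lookup (insertBefore s τ))
                    (trans (cong (lookup (insertBefore s τ)) h) (step-fromℕ (iter τ k v) eq)))
                    (trans lookup-fromℕ (cong inject₁ (sym (eqF⇒≡ eq))))

    σ-orbit⊆τ-orbit : ∀ v k′ → iter (insertBefore s τ) k′ (inject₁ v) ≡ fromℕ n
                                ⊎ ∃ λ k → iter (insertBefore s τ) k′ (inject₁ v) ≡ inject₁ (iter τ k v)
    σ-orbit⊆τ-orbit v k′ = Sum.map₁ proj₁ (go k′)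
      where
      go : ∀ k′ → (iter (insertBefore s τ) k′ (inject₁ v) ≡ fromℕ n × ∃ λ k → iter τ k v ≡ s)
                  ⊎ ∃ λ k → iter (insertBefore s τ) k′ (inject₁ v) ≡ inject₁ (iter τ k v)
      go zero = inj₂ (zero , refl)
      go (suc k′) with go k′
      ... | inj₁ (h , k , τᵏv≡s) =
        inj₂ (k , trans (cong (lookup (insertBefore s τ)) h) (trans lookup-fromℕ (cong inject₁ (sym τᵏv≡s))))
      ... | inj₂ (k , h) with eqF (lookup τ (iter τ k v)) s in eq
      ... | true  = inj₁ (trans (cong (lookup (insertBefore s τ)) h) (step-fromℕ (iter τ k v) eq) , suc k , eqF⇒≡ eq)
      ... | false = inj₂ (suc k , trans (cong (lookup (insertBefore s τ)) h) (step-inject₁ (iter τ k v) eq))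

    cyclesB-insertBefore : Injective _≡_ _≡_ (lookup τ) → cyclesB (insertBefore s τ) ≡ cyclesB τ
    cyclesB-insertBefore τ-inj = begin
      cyclesB (insertBefore s τ)                                                 ≡⟨ cyclesB-via-last (insertBefore s τ) τ σ-inj τ-inj orbits ⟩
      cyclesB τ ℕ.+ (if isOrbitMin (insertBefore s τ) (fromℕ n) then 1 else 0)   ≡⟨ cong (λ b → cyclesB τ ℕ.+ (if b then 1 else 0)) last-not-min ⟩
      cyclesB τ ℕ.+ 0                                                            ≡⟨ ℕ.+-identityʳ _ ⟩
      cyclesB τ                                                                  ∎
      where
      open ≡-Reasoning
      σ-inj = extend-injective⁺ τ τ-inj
      orbits : ∀ v → OrbitMin (insertBefore s τ) (inject₁ v) ⇔ OrbitMin τ v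
      orbits v = OrbitMin-inject₁ (insertBefore s τ) τ v (τ-orbit⊆σ-orbit v) (σ-orbit⊆τ-orbit v)
      last-not-min : isOrbitMin (insertBefore s τ) (fromℕ n) ≡ false
      last-not-min with isOrbitMin (insertBefore s τ) (fromℕ n) in eq
      ... | false = refl
      ... | true  = ⊥-elim (ℕ.<⇒≱ σL<L (isOrbitMin-true⁻ (insertBefore s τ) σ-inj (fromℕ n) eq 1))
        where
        σL<L : toℕ (iter (insertBefore s τ) 1 (fromℕ n)) < toℕ (fromℕ n)
        σL<L = subst₂ _<_ (sym (trans (cong toℕ lookup-fromℕ) (Fin.toℕ-inject₁ s))) (sym (Fin.toℕ-fromℕ n)) (Fin.toℕ<n s)

  indicator : Bool → ℚ
  indicator b = if b then 1ℚ else 0ℚ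

  weight : (Fin n → Fin n → Bool) → ℚ → Vec (Fin n) n → ℚ
  weight e x σ = if isCycleCover e σ then pow x (cyclesB σ) else 0ℚ

  cycleCoverPoly-∑ : ∀ (e : Fin n → Fin n → Bool) x → cycleCoverPoly e x ≡ ∑[ σ ∈ allMaps n n ] weight e x σ
  cycleCoverPoly-∑ {n} e x = ∑-filter (isCycleCover e) (allMaps n n) (λ σ → pow x (cyclesB σ))

  allB-cong : ∀ {f g : Fin n → Bool} → (∀ x → f x ≡ g x) → allB f ≡ allB g
  allB-cong f≡g = ≡-from-≡true (λ h → allB-true⁺ _ (λ x → trans (sym (f≡g x)) (allB-true⁻ _ h x)))
                               (λ h → allB-true⁺ _ (λ x → trans (f≡g x) (allB-true⁻ _ h x)))

  cycleCoverPoly-cong : ∀ {e e′ : Fin n → Fin n → Bool} → (∀ r t → e r t ≡ e′ r t) → ∀ x →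
    cycleCoverPoly e x ≡ cycleCoverPoly e′ x
  cycleCoverPoly-cong {n} {e} {e′} e≡e′ x = begin
    cycleCoverPoly e x                 ≡⟨ cycleCoverPoly-∑ e x ⟩
    ∑ (allMaps n n) (weight e x)       ≡⟨ ∑-cong (allMaps n n) (λ σ → cong (λ b → if injectiveB σ ∧ b then pow x (cyclesB σ) else 0ℚ)
                                            (allB-cong (λ v → e≡e′ v (lookup σ v)))) ⟩
    ∑ (allMaps n n) (weight e′ x)      ≡⟨ sym (cycleCoverPoly-∑ e′ x) ⟩
    cycleCoverPoly e′ x                ∎
    where open ≡-Reasoning

  cycleCoverPoly-cast : ∀ {m} (eq : m ≡ n) (e : Fin m → Fin m → Bool) (e′ : Fin n → Fin n → Bool) →
    (∀ r t → e′ r t ≡ e (Fin.cast (sym eq) r) (Fin.cast (sym eq) t)) → ∀ x → cycleCoverPoly e x ≡ cycleCoverPoly e′ x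
  cycleCoverPoly-cast refl e e′ e′≡e x = cycleCoverPoly-cong
    (λ r t → sym (trans (e′≡e r t) (cong₂ e (Fin.cast-is-id refl r) (Fin.cast-is-id refl t)))) x

  deleteLast : (Fin (suc n) → Fin (suc n) → Bool) → Fin n → Fin n → Bool
  deleteLast e r t = e (inject₁ r) (inject₁ t)

  -- An edge r → s of bypassLast e s stands for the path r → last → s of e.
  bypassLast : (Fin (suc n) → Fin (suc n) → Bool) → Fin n → Fin n → Fin n → Bool
  bypassLast e s r t = e (inject₁ r) (redirect s t)

  module DeleteLast {n} (e : Fin (suc n) → Fin (suc n) → Bool) (x : ℚ) where

    L : Fin (suc n)
    L = fromℕ n

    weight-∷ʳ-repeated : ∀ τ y r → lookup τ r ≡ y → weight e x (τ ∷ʳ y) ≡ 0ℚ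
    weight-∷ʳ-repeated τ y r τr≡y with injectiveB (τ ∷ʳ y) in inj
    ... | false = refl
    ... | true  = ⊥-elim (Fin.fromℕ≢inject₁ (sym (injectiveB-true⁻ (τ ∷ʳ y) inj
                    (trans (lookup-∷ʳ-inject₁ τ y r) (trans τr≡y (sym (lookup-∷ʳ-fromℕ τ y)))))))

    weight-withLoop : ∀ τ → weight e x (withLoop τ) ≡ indicator (e L L) * (x * weight (deleteLast e) x τ)
    weight-withLoop τ rewrite WithLoop.isCycleCover-extend τ e (deleteLast e) (λ _ _ → refl) τ
      with e L L | isCycleCover (deleteLast e) τ in cover
    ... | false | c     = sym (ℚ.*-zeroˡ (x * (if c then pow x (cyclesB τ) else 0ℚ)))
    ... | true  | false = sym (trans (ℚ.*-identityˡ _) (ℚ.*-zeroʳ x))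
    ... | true  | true  = trans (cong (pow x) (WithLoop.cyclesB-withLoop τ (injectiveB-true⁻ τ (Bool.∧-conicalˡ _ _ cover))))
                                (sym (ℚ.*-identityˡ _))

    weight-insertBefore : ∀ s τ → weight e x (insertBefore s τ) ≡ indicator (e L (inject₁ s)) * weight (bypassLast e s) x τ
    weight-insertBefore s τ rewrite InsertBefore.isCycleCover-extend s τ e (bypassLast e s) (λ _ _ → refl) τ
      with e L (inject₁ s) | isCycleCover (bypassLast e s) τ in cover
    ... | false | c     = sym (ℚ.*-zeroˡ (if c then pow x (cyclesB τ) else 0ℚ))
    ... | true  | false = sym (ℚ.*-identityˡ _)
    ... | true  | true  = trans (cong (pow x) (InsertBefore.cyclesB-insertBefore s τ (injectiveB-true⁻ τ (Bool.∧-conicalˡ _ _ cover))))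
                                (sym (ℚ.*-identityˡ _))

    ∑-split-fromℕ : ∀ h → ∑ (allFin (suc n)) h ≡ h L + ∑[ z ∈ allFin n ] h (inject₁ z)
    ∑-split-fromℕ h = trans (∑-allFin-last n h) (ℚ.+-comm _ (h L))

    ∑-split-inject₁ : ∀ s h → ∑ (allFin (suc n)) h ≡ h (inject₁ s) + ∑[ z ∈ allFin n ] h (redirect s z)
    ∑-split-inject₁ s h = begin
      ∑ (allFin (suc n)) h                                                       ≡⟨ ∑-allFin-last n h ⟩
      ∑ (allFin n) (h ∘ inject₁) + h L                                           ≡⟨ sym (∑-update n s (h L) (h ∘ inject₁)) ⟩
      ∑[ z ∈ allFin n ] (if eqF z s then h L else h (inject₁ z)) + h (inject₁ s) ≡⟨ cong (_+ h (inject₁ s)) (∑-cong (allFin n) h∘redirect) ⟩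
      ∑ (allFin n) (h ∘ redirect s) + h (inject₁ s)                              ≡⟨ ℚ.+-comm _ (h (inject₁ s)) ⟩
      h (inject₁ s) + ∑ (allFin n) (h ∘ redirect s)                              ∎
      where
      open ≡-Reasoning
      h∘redirect : ∀ z → (if eqF z s then h L else h (inject₁ z)) ≡ h (redirect s z)
      h∘redirect z with eqF z s
      ... | true  = refl
      ... | false = refl

    lastImage : Fin (suc n) → ℚ
    lastImage y = ∑[ τ ∈ allMaps (suc n) n ] weight e x (τ ∷ʳ y)

    lastImage-fromℕ : lastImage L ≡ indicator (e L L) * (x * cycleCoverPoly (deleteLast e) x)
    lastImage-fromℕ = begin
      lastImage L                                                     ≡⟨ ∑-allMaps-avoiding n L inject₁ ∑-split-fromℕ n _
                                                                           (λ τ r → weight-∷ʳ-repeated τ L r) ⟩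
      ∑[ τ ∈ allMaps n n ] weight e x (withLoop τ)                    ≡⟨ ∑-cong (allMaps n n) weight-withLoop ⟩
      ∑[ τ ∈ allMaps n n ] (indicator (e L L) * (x * weight (deleteLast e) x τ))
                                                                      ≡⟨ *-distribˡ-∑ (indicator (e L L)) (allMaps n n) _ ⟩
      indicator (e L L) * ∑[ τ ∈ allMaps n n ] (x * weight (deleteLast e) x τ)
                                                                      ≡⟨ cong (indicator (e L L) *_) (*-distribˡ-∑ x (allMaps n n) (weight (deleteLast e) x)) ⟩
      indicator (e L L) * (x * ∑ (allMaps n n) (weight (deleteLast e) x))
                                                                      ≡⟨ cong (λ c → indicator (e L L) * (x * c)) (sym (cycleCoverPoly-∑ (deleteLast e) x)) ⟩
      indicator (e L L) * (x * cycleCoverPoly (deleteLast e) x)       ∎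
      where open ≡-Reasoning

    lastImage-inject₁ : ∀ s → lastImage (inject₁ s) ≡ indicator (e L (inject₁ s)) * cycleCoverPoly (bypassLast e s) x
    lastImage-inject₁ s = begin
      lastImage (inject₁ s)                                           ≡⟨ ∑-allMaps-avoiding n (inject₁ s) (redirect s) (∑-split-inject₁ s) n _
                                                                           (λ τ r → weight-∷ʳ-repeated τ (inject₁ s) r) ⟩
      ∑[ τ ∈ allMaps n n ] weight e x (insertBefore s τ)              ≡⟨ ∑-cong (allMaps n n) (weight-insertBefore s) ⟩
      ∑[ τ ∈ allMaps n n ] (indicator (e L (inject₁ s)) * weight (bypassLast e s) x τ)
                                                                      ≡⟨ *-distribˡ-∑ (indicator (e L (inject₁ s))) (allMaps n n) (weight (bypassLast e s) x) ⟩
      indicator (e L (inject₁ s)) * ∑ (allMaps n n) (weight (bypassLast e s) x)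
                                                                      ≡⟨ cong (indicator (e L (inject₁ s)) *_) (sym (cycleCoverPoly-∑ (bypassLast e s) x)) ⟩
      indicator (e L (inject₁ s)) * cycleCoverPoly (bypassLast e s) x ∎
      where open ≡-Reasoning

    -- Split the cycle covers σ according to the image σ(last) of the last vertex.
    cycleCoverPoly-deleteLast : cycleCoverPoly e x ≡
      ∑[ s ∈ allFin n ] (indicator (e L (inject₁ s)) * cycleCoverPoly (bypassLast e s) x)
      + indicator (e L L) * (x * cycleCoverPoly (deleteLast e) x)
    cycleCoverPoly-deleteLast = begin
      cycleCoverPoly e x                                                         ≡⟨ cycleCoverPoly-∑ e x ⟩
      ∑ (allMaps (suc n) (suc n)) (weight e x)                                   ≡⟨ ∑-allMaps-∷ʳ (suc n) n (weight e x) ⟩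
      ∑[ τ ∈ allMaps (suc n) n ] ∑[ y ∈ allFin (suc n) ] weight e x (τ ∷ʳ y)     ≡⟨ ∑-comm (allMaps (suc n) n) (allFin (suc n)) _ ⟩
      ∑ (allFin (suc n)) lastImage                                               ≡⟨ ∑-allFin-last n lastImage ⟩
      ∑ (allFin n) (lastImage ∘ inject₁) + lastImage L                           ≡⟨ cong₂ _+_ (∑-cong (allFin n) lastImage-inject₁) lastImage-fromℕ ⟩
      ∑[ s ∈ allFin n ] (indicator (e L (inject₁ s)) * cycleCoverPoly (bypassLast e s) x)
        + indicator (e L L) * (x * cycleCoverPoly (deleteLast e) x)              ∎
      where open ≡-Reasoning

  labelled : (ℕ → ℕ → Bool) → (ps : List ℕ) → Fin (length ps) → Fin (length ps) → Bool
  labelled E ps r s = E (List.lookup ps r) (List.lookup ps s)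

  cycleCoverPoly-labelled-cong : ∀ {E E′ : ℕ → ℕ → Bool} ps → (∀ {P Q} → P ∈ ps → Q ∈ ps → E P Q ≡ E′ P Q) → ∀ x →
    cycleCoverPoly (labelled E ps) x ≡ cycleCoverPoly (labelled E′ ps) x
  cycleCoverPoly-labelled-cong ps E≡E′ = cycleCoverPoly-cong (λ r t → E≡E′ (∈-lookup r) (∈-lookup t))

  length-∷ʳ : ∀ (qs : List A) a → length (qs ++ [ a ]) ≡ suc (length qs)
  length-∷ʳ qs a = trans (List.length-++ qs) (ℕ.+-comm (length qs) 1)

  module _ (ps : List ℕ) (a : ℕ) where

    cast∷ʳ : Fin (suc (length ps)) → Fin (length (ps ++ [ a ]))
    cast∷ʳ = Fin.cast (sym (length-∷ʳ ps a))

    lookup-++-inject₁ : ∀ r → List.lookup (ps ++ [ a ]) (cast∷ʳ (inject₁ r)) ≡ List.lookup ps r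
    lookup-++-inject₁ = go ps
      where
      go : ∀ qs r → List.lookup (qs ++ [ a ]) (Fin.cast (sym (length-∷ʳ qs a)) (inject₁ r)) ≡ List.lookup qs r
      go (q ∷ qs) Fin.zero    = refl
      go (q ∷ qs) (Fin.suc r) = go qs r

    lookup-++-fromℕ : List.lookup (ps ++ [ a ]) (cast∷ʳ (fromℕ (length ps))) ≡ a
    lookup-++-fromℕ = go ps
      where
      go : ∀ qs → List.lookup (qs ++ [ a ]) (Fin.cast (sym (length-∷ʳ qs a)) (fromℕ (length qs))) ≡ a
      go []       = refl
      go (q ∷ qs) = go qs

    lookup-++-redirect : ∀ s t → List.lookup (ps ++ [ a ]) (cast∷ʳ (redirect s t))
                                   ≡ (if eqF t s then a else List.lookup ps t)
    lookup-++-redirect s t with eqF t s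
    ... | true  = lookup-++-fromℕ
    ... | false = lookup-++-inject₁ t

    cycleCoverPoly-labelled-∷ʳ : ∀ E x → cycleCoverPoly (labelled E (ps ++ [ a ])) x ≡
      ∑[ s ∈ allFin (length ps) ] (indicator (E a (List.lookup ps s))
                                    * cycleCoverPoly (λ r t → E (List.lookup ps r) (if eqF t s then a else List.lookup ps t)) x)
      + indicator (E a a) * (x * cycleCoverPoly (labelled E ps) x)
    cycleCoverPoly-labelled-∷ʳ E x = begin
      cycleCoverPoly (labelled E (ps ++ [ a ])) x
        ≡⟨ cycleCoverPoly-cast (length-∷ʳ ps a) (labelled E (ps ++ [ a ])) e (λ _ _ → refl) x ⟩
      cycleCoverPoly e x
        ≡⟨ cycleCoverPoly-deleteLast ⟩
      ∑[ s ∈ allFin (length ps) ] (indicator (e L (inject₁ s)) * cycleCoverPoly (bypassLast e s) x)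
        + indicator (e L L) * (x * cycleCoverPoly (deleteLast e) x)
        ≡⟨ cong₂ _+_ (∑-cong (allFin (length ps)) (λ s → cong₂ _*_ (cong indicator (e-L s)) (cycleCoverPoly-cong (bypass s) x)))
                     (cong₂ _*_ (cong indicator e-L-L) (cong (x *_) (cycleCoverPoly-cong delete x))) ⟩
      ∑[ s ∈ allFin (length ps) ] (indicator (E a (List.lookup ps s))
                                    * cycleCoverPoly (λ r t → E (List.lookup ps r) (if eqF t s then a else List.lookup ps t)) x)
      + indicator (E a a) * (x * cycleCoverPoly (labelled E ps) x) ∎
      where
      open ≡-Reasoning
      e : Fin (suc (length ps)) → Fin (suc (length ps)) → Bool
      e r t = labelled E (ps ++ [ a ]) (cast∷ʳ r) (cast∷ʳ t)
      open DeleteLast e x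
      e-L : ∀ s → e L (inject₁ s) ≡ E a (List.lookup ps s)
      e-L s = cong₂ E lookup-++-fromℕ (lookup-++-inject₁ s)
      e-L-L : e L L ≡ E a a
      e-L-L = cong₂ E lookup-++-fromℕ lookup-++-fromℕ
      bypass : ∀ s r t → bypassLast e s r t ≡ E (List.lookup ps r) (if eqF t s then a else List.lookup ps t)
      bypass s r t = cong₂ E (lookup-++-inject₁ r) (lookup-++-redirect s t)
      delete : ∀ r t → deleteLast e r t ≡ labelled E ps r t
      delete r t = cong₂ E (lookup-++-inject₁ r) (lookup-++-inject₁ t)

module BalancedWords where

  open import Data.Nat as ℕ using (ℕ; zero; suc; _+_; _∸_; _≤_; _<_; z≤n; s≤s; _≡ᵇ_)
  import Data.Nat.Properties as ℕ
  open import Data.Bool using (if_then_else_)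
  open import Data.List as List using ([]; _∷_; _++_; drop; length)
  import Data.List.Properties as List
  open import Data.List.Relation.Unary.All as All using (All; []; _∷_)
  import Data.List.Relation.Unary.All.Properties as All
  open import Data.Product using (∃; _×_; _,_; proj₁; proj₂)
  open import Data.Sum using (_⊎_; inj₁; inj₂)
  open import Function using (_∘_)
  open import Relation.Binary.PropositionalEquality
  open import Relation.Nullary using (¬_)
  open import Relation.Nullary.Decidable using (dec-true; dec-false)

  #ann #cre : Word → ℕ
  #ann []              = 0
  #ann ((_ , ann) ∷ w) = suc (#ann w)
  #ann ((_ , cre) ∷ w) = #ann w
  #cre []              = 0
  #cre ((_ , ann) ∷ w) = #cre w
  #cre ((_ , cre) ∷ w) = suc (#cre w)

  -- The colour-blind shadow of IsDyck: a Dyck path in the letters * and 1 read from the right.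
  record Balanced (W : Word) : Set where
    field
      suffix : ∀ j → #ann (drop j W) ≤ #cre (drop j W)
      total  : #ann W ≡ #cre W

  Creators : Word → Set
  Creators = All (λ l → proj₂ l ≡ cre)

  #ann-Creators : ∀ {C} → Creators C → #ann C ≡ 0
  #ann-Creators []         = refl
  #ann-Creators (refl ∷ c) = #ann-Creators c

  Creators-++-ann : ∀ X i Y → ¬ Creators (X ++ (i , ann) ∷ Y)
  Creators-++-ann []      i Y (() ∷ _)
  Creators-++-ann (x ∷ X) i Y (_ ∷ c) = Creators-++-ann X i Y c

  drop-++-≤ : ∀ n (X Y : Word) → n ≤ length X → drop n (X ++ Y) ≡ drop n X ++ Y
  drop-++-≤ zero    X       Y n≤ = refl
  drop-++-≤ (suc n) (x ∷ X) Y (s≤s n≤) = drop-++-≤ n X Y n≤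

  drop-++-≥ : ∀ n (X Y : Word) → length X ≤ n → drop n (X ++ Y) ≡ drop (n ∸ length X) Y
  drop-++-≥ n       []      Y _ = refl
  drop-++-≥ (suc n) (x ∷ X) Y (s≤s n≥) = drop-++-≥ n X Y n≥

  drop-length-++ : ∀ (X Y : Word) → drop (length X) (X ++ Y) ≡ Y
  drop-length-++ []      Y = refl
  drop-length-++ (x ∷ X) Y = drop-length-++ X Y

  length-++-pair : ∀ (X : Word) x y Y → length (X ++ x ∷ y ∷ Y) ≡ suc (suc (length (X ++ Y)))
  length-++-pair X x y Y = trans (List.length-++-sucʳ X x (y ∷ Y)) (cong suc (List.length-++-sucʳ X y Y))

  lastAnnihilator : ∀ W → Creators W ⊎ ∃ λ A → ∃ λ i → ∃ λ C → W ≡ A ++ (i , ann) ∷ C × Creators C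
  lastAnnihilator [] = inj₁ []
  lastAnnihilator (x ∷ W) with lastAnnihilator W
  ... | inj₂ (A , i , C , refl , c) = inj₂ (x ∷ A , i , C , refl , c)
  lastAnnihilator ((i , ann) ∷ W) | inj₁ c = inj₂ ([] , i , W , refl , c)
  lastAnnihilator ((i , cre) ∷ W) | inj₁ c = inj₁ (refl ∷ c)

  module _ (i j : ℕ) where

    #ann-++-pair : ∀ X Y → #ann (X ++ (i , ann) ∷ (j , cre) ∷ Y) ≡ suc (#ann (X ++ Y))
    #ann-++-pair []              Y = refl
    #ann-++-pair ((_ , ann) ∷ X) Y = cong suc (#ann-++-pair X Y)
    #ann-++-pair ((_ , cre) ∷ X) Y = #ann-++-pair X Y

    #cre-++-pair : ∀ X Y → #cre (X ++ (i , ann) ∷ (j , cre) ∷ Y) ≡ suc (#cre (X ++ Y))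
    #cre-++-pair []              Y = refl
    #cre-++-pair ((_ , ann) ∷ X) Y = #cre-++-pair X Y
    #cre-++-pair ((_ , cre) ∷ X) Y = cong suc (#cre-++-pair X Y)

    Balanced-remove-pair : ∀ A B → Creators B → Balanced (A ++ (i , ann) ∷ (j , cre) ∷ B) → Balanced (A ++ B)
    Balanced-remove-pair A B c bal = record { suffix = suffix ; total = total }
      where
      open Balanced bal renaming (suffix to suffixW; total to totalW)
      total : #ann (A ++ B) ≡ #cre (A ++ B)
      total = ℕ.suc-injective (trans (sym (#ann-++-pair A B)) (trans totalW (#cre-++-pair A B)))
      suffix : ∀ n → #ann (drop n (A ++ B)) ≤ #cre (drop n (A ++ B))
      suffix n with ℕ.≤-total n (length A)
      ... | inj₁ n≤ rewrite drop-++-≤ n A B n≤ = ℕ.≤-pred (subst₂ _≤_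
            (#ann-++-pair (drop n A) B) (#cre-++-pair (drop n A) B)
            (subst (λ w → #ann w ≤ #cre w) (drop-++-≤ n A _ n≤) (suffixW n)))
      ... | inj₂ n≥ rewrite drop-++-≥ n A B n≥ | #ann-Creators (All.drop⁺ (n ∸ length A) c) = z≤n

  Creators-balanced⇒[] : ∀ {W} → Creators W → #ann W ≡ #cre W → W ≡ []
  Creators-balanced⇒[] []         _  = refl
  Creators-balanced⇒[] (refl ∷ c) eq with () ← trans (sym (#ann-Creators c)) eq

  Decomposition : Word → Set
  Decomposition W = ∃ λ A → ∃ λ i → ∃ λ j → ∃ λ B →
    W ≡ A ++ (i , ann) ∷ (j , cre) ∷ B × Creators B × Balanced (A ++ B)

  -- Cut a nonempty balanced word at its last annihilator, which is immediately followed by its partner.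
  decompose : ∀ W → Balanced W → W ≡ [] ⊎ Decomposition W
  decompose W bal with lastAnnihilator W
  ... | inj₁ c = inj₁ (Creators-balanced⇒[] c (Balanced.total bal))
  decompose .(A ++ (i , ann) ∷ []) bal | inj₂ (A , i , [] , refl , c)
    with () ← subst (λ w → #ann w ≤ #cre w) (drop-length-++ A _) (Balanced.suffix bal (length A))
  decompose .(A ++ (i , ann) ∷ (j , cre) ∷ B) bal | inj₂ (A , i , (j , .cre) ∷ B , refl , refl ∷ c) =
    inj₂ (A , i , j , B , refl , c , Balanced-remove-pair i j A B c bal)

  Balanced-induction : ∀ {ℓ} (P : Word → Set ℓ) → P [] →
    (∀ A i j B → Creators B → Balanced (A ++ B) →
       (∀ V → Balanced V → length V ≤ length (A ++ B) → P V) → P (A ++ (i , ann) ∷ (j , cre) ∷ B)) →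
    ∀ W → Balanced W → P W
  Balanced-induction P base step W = go (length W) W ℕ.≤-refl
    where
    go : ∀ n V → length V ≤ n → Balanced V → P V
    go n V _ bal with decompose V bal
    ... | inj₁ refl = base
    go zero    _ V≤0 _ | inj₂ (A , i , j , B , refl , _ , _)
      with () ← subst (_≤ 0) (length-++-pair A (i , ann) (j , cre) B) V≤0
    go (suc n) _ V≤n _ | inj₂ (A , i , j , B , refl , c , bal′) = step A i j B c bal′
      (λ V bal V≤ → go n V (ℕ.≤-trans V≤ U≤n) bal)
      where
      U≤n : length (A ++ B) ≤ n
      U≤n = ℕ.≤-trans (ℕ.n≤1+n _) (ℕ.≤-pred (subst (_≤ suc n) (length-++-pair A (i , ann) (j , cre) B) V≤n))

  ∑ℕ< : ℕ → (ℕ → ℕ) → ℕ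
  ∑ℕ< zero    f = 0
  ∑ℕ< (suc M) f = ∑ℕ< M f + f M

  ∑ℕ<-+ : ∀ M (f g : ℕ → ℕ) → ∑ℕ< M (λ i → f i + g i) ≡ ∑ℕ< M f + ∑ℕ< M g
  ∑ℕ<-+ zero    f g = refl
  ∑ℕ<-+ (suc M) f g = trans (cong (_+ (f M + g M)) (∑ℕ<-+ M f g)) (+-interchange (∑ℕ< M f) (∑ℕ< M g) (f M) (g M))
    where open import Algebra.Properties.CommutativeSemigroup ℕ.+-commutativeSemigroup using () renaming (interchange to +-interchange)

  ∑ℕ<-cong : ∀ M {f g : ℕ → ℕ} → (∀ i → f i ≡ g i) → ∑ℕ< M f ≡ ∑ℕ< M g
  ∑ℕ<-cong zero    eq = refl
  ∑ℕ<-cong (suc M) eq = cong₂ _+_ (∑ℕ<-cong M eq) (eq M)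

  ∑ℕ<-mono : ∀ M {f g : ℕ → ℕ} → (∀ i → f i ≤ g i) → ∑ℕ< M f ≤ ∑ℕ< M g
  ∑ℕ<-mono zero    le = z≤n
  ∑ℕ<-mono (suc M) le = ℕ.+-mono-≤ (∑ℕ<-mono M le) (le M)

  ∑ℕ<-zero : ∀ M {f : ℕ → ℕ} → (∀ i → i < M → f i ≡ 0) → ∑ℕ< M f ≡ 0
  ∑ℕ<-zero zero    _    = refl
  ∑ℕ<-zero (suc M) f≡0 = cong₂ _+_ (∑ℕ<-zero M (λ i i<M → f≡0 i (ℕ.m<n⇒m<1+n i<M))) (f≡0 M (ℕ.n<1+n M))

  ∑ℕ<-indicator : ∀ M c → c < M → ∑ℕ< M (λ i → if i ≡ᵇ c then 1 else 0) ≡ 1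
  ∑ℕ<-indicator (suc M) c (s≤s c≤M) with ℕ.m≤n⇒m<n∨m≡n c≤M
  ... | inj₁ c<M rewrite ∑ℕ<-indicator M c c<M | dec-false (M ℕ.≟ c) (ℕ.<⇒≢ c<M ∘ sym) = refl
  ... | inj₂ refl rewrite dec-true (c ℕ.≟ c) refl =
    cong (_+ 1) (∑ℕ<-zero c (λ i i<c → cong (λ b → if b then 1 else 0) (dec-false (i ℕ.≟ c) (ℕ.<⇒≢ i<c))))

  ColoursBelow : ℕ → Word → Set
  ColoursBelow M = All (λ l → proj₁ l < M)

  colourBound : Word → ℕ
  colourBound = List.foldr (λ l m → suc (proj₁ l) + m) 0

  ColoursBelow-colourBound : ∀ W → ColoursBelow (colourBound W) W
  ColoursBelow-colourBound []            = []
  ColoursBelow-colourBound ((c , _) ∷ W) = s≤s (ℕ.m≤m+n c _)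
    ∷ All.map (λ l<M → ℕ.<-≤-trans l<M (ℕ.m≤n+m _ (suc c))) (ColoursBelow-colourBound W)

  #ann-∑-countAnn : ∀ M V → ColoursBelow M V → #ann V ≡ ∑ℕ< M (λ i → countAnn i V)
  #ann-∑-countAnn M []              []          = sym (∑ℕ<-zero M (λ _ _ → refl))
  #ann-∑-countAnn M ((c , cre) ∷ V) (_ ∷ below) = #ann-∑-countAnn M V below
  #ann-∑-countAnn M ((c , ann) ∷ V) (c<M ∷ below) = trans
    (cong₂ _+_ (sym (∑ℕ<-indicator M c c<M)) (#ann-∑-countAnn M V below))
    (sym (∑ℕ<-+ M (λ i → if i ≡ᵇ c then 1 else 0) (λ i → countAnn i V)))

  #cre-∑-countCre : ∀ M V → ColoursBelow M V → #cre V ≡ ∑ℕ< M (λ i → countCre i V)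
  #cre-∑-countCre M []              []          = sym (∑ℕ<-zero M (λ _ _ → refl))
  #cre-∑-countCre M ((c , ann) ∷ V) (_ ∷ below) = #cre-∑-countCre M V below
  #cre-∑-countCre M ((c , cre) ∷ V) (c<M ∷ below) = trans
    (cong₂ _+_ (sym (∑ℕ<-indicator M c c<M)) (#cre-∑-countCre M V below))
    (sym (∑ℕ<-+ M (λ i → if i ≡ᵇ c then 1 else 0) (λ i → countCre i V)))

  drop-≥-length : ∀ j (V : Word) → length V ≤ j → drop j V ≡ []
  drop-≥-length zero    []      _        = refl
  drop-≥-length (suc j) []      _        = refl
  drop-≥-length (suc j) (l ∷ V) (s≤s le) = drop-≥-length j V le

  -- Sum the colourwise conditions over all colours occurring in W.
  IsDyck⇒Balanced : ∀ W → IsDyck W → Balanced W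
  IsDyck⇒Balanced W dyck = record { suffix = suffix ; total = total }
    where
    M = colourBound W
    below : ∀ j → ColoursBelow M (drop j W)
    below j = All.drop⁺ j (ColoursBelow-colourBound W)
    suffix : ∀ j → #ann (drop j W) ≤ #cre (drop j W)
    suffix j with ℕ.≤-total j (length W)
    ... | inj₁ j≤W = subst₂ _≤_ (sym (#ann-∑-countAnn M _ (below j))) (sym (#cre-∑-countCre M _ (below j)))
                       (∑ℕ<-mono M (λ i → IsDyck.suffix dyck i j j≤W))
    ... | inj₂ W≤j rewrite drop-≥-length j W W≤j = z≤n
    total : #ann W ≡ #cre W
    total = trans (#ann-∑-countAnn M W (below 0)) (trans (∑ℕ<-cong M (λ i → sym (IsDyck.total dyck i)))
                  (sym (#cre-∑-countCre M W (below 0))))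

module Matching where

  open import Data.Nat as ℕ using (ℕ; zero; suc; _+_; _∸_; _≤_; _<_; z≤n; s≤s; _<ᵇ_; _≤ᵇ_; _≡ᵇ_)
  import Data.Nat.Properties as ℕ
  open import Data.Bool using (true; false; if_then_else_)
  open import Data.Rational as ℚ using (ℚ; 0ℚ)
  import Data.Rational.Properties as ℚ
  open import Data.List as List using (List; []; _∷_; _++_; [_]; drop; length; map)
  import Data.List.Properties as List
  open import Data.List.Relation.Unary.All using ([]; _∷_)
  import Data.List.Relation.Unary.All.Properties as All
  open import Data.List.Relation.Unary.Any using (here; there)
  open import Data.List.Membership.Propositional using (_∈_)
  open import Data.List.Membership.Propositional.Properties using (∈-++⁻; ∈-lookup)
  import Data.Fin as Fin
  open import Data.Product using (_×_; _,_; proj₂)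
  open import Data.Sum using (_⊎_; inj₁; inj₂)
  open import Data.Empty using (⊥-elim)
  open import Function using (_∘_)
  open import Relation.Binary.PropositionalEquality hiding ([_])
  open import Relation.Nullary using (yes; no)
  open import Relation.Nullary.Decidable using (dec-true; dec-false)
  open FiniteSums
  open BalancedWords

  annPosFrom-++ : ∀ q X Y → annPosFrom q (X ++ Y) ≡ annPosFrom q X ++ annPosFrom (q + length X) Y
  annPosFrom-++ q [] Y rewrite ℕ.+-identityʳ q = refl
  annPosFrom-++ q ((_ , ann) ∷ X) Y rewrite annPosFrom-++ (suc q) X Y | ℕ.+-suc q (length X) = refl
  annPosFrom-++ q ((_ , cre) ∷ X) Y rewrite annPosFrom-++ (suc q) X Y | ℕ.+-suc q (length X) = refl

  annPosFrom-Creators : ∀ q {C} → Creators C → annPosFrom q C ≡ []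
  annPosFrom-Creators q []         = refl
  annPosFrom-Creators q (refl ∷ c) = annPosFrom-Creators (suc q) c

  annPositions-++-Creators : ∀ A B → Creators B → annPositions (A ++ B) ≡ annPositions A
  annPositions-++-Creators A B c
    rewrite annPosFrom-++ 0 A B | annPosFrom-Creators (length A) c = List.++-identityʳ _

  annPositions-++-pair : ∀ A i j B → Creators B →
    annPositions (A ++ (i , ann) ∷ (j , cre) ∷ B) ≡ annPositions A ++ [ length A ]
  annPositions-++-pair A i j B c
    rewrite annPosFrom-++ 0 A ((i , ann) ∷ (j , cre) ∷ B) | annPosFrom-Creators (suc (suc (length A))) c = refl

  annPosFrom-≥ : ∀ q X {t} → t ∈ annPosFrom q X → q ≤ t
  annPosFrom-≥ q ((_ , ann) ∷ X) (here refl) = ℕ.≤-refl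
  annPosFrom-≥ q ((_ , ann) ∷ X) (there t∈)  = ℕ.≤-trans (ℕ.n≤1+n q) (annPosFrom-≥ (suc q) X t∈)
  annPosFrom-≥ q ((_ , cre) ∷ X) t∈          = ℕ.≤-trans (ℕ.n≤1+n q) (annPosFrom-≥ (suc q) X t∈)

  annPosFrom-< : ∀ q X {t} → t ∈ annPosFrom q X → t < q + length X
  annPosFrom-< q ((_ , ann) ∷ X) (here refl) = ℕ.m<m+n q (s≤s z≤n)
  annPosFrom-< q ((_ , ann) ∷ X) {t} (there t∈) = subst (t <_) (sym (ℕ.+-suc q (length X))) (annPosFrom-< (suc q) X t∈)
  annPosFrom-< q ((_ , cre) ∷ X) {t} t∈         = subst (t <_) (sym (ℕ.+-suc q (length X))) (annPosFrom-< (suc q) X t∈)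

  annPositions-< : ∀ X {t} → t ∈ annPositions X → t < length X
  annPositions-< = annPosFrom-< 0

  lookup-annPosFrom-injective : ∀ q X {r r′} → List.lookup (annPosFrom q X) r ≡ List.lookup (annPosFrom q X) r′ → r ≡ r′
  lookup-annPosFrom-injective q ((_ , ann) ∷ X) {Fin.zero}  {Fin.zero}   eq = refl
  lookup-annPosFrom-injective q ((_ , ann) ∷ X) {Fin.zero}  {Fin.suc r′} eq =
    ⊥-elim (ℕ.<-irrefl eq (annPosFrom-≥ (suc q) X (∈-lookup r′)))
  lookup-annPosFrom-injective q ((_ , ann) ∷ X) {Fin.suc r} {Fin.zero}   eq =
    ⊥-elim (ℕ.<-irrefl (sym eq) (annPosFrom-≥ (suc q) X (∈-lookup r)))
  lookup-annPosFrom-injective q ((_ , ann) ∷ X) {Fin.suc r} {Fin.suc r′} eq = cong Fin.suc (lookup-annPosFrom-injective (suc q) X eq)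
  lookup-annPosFrom-injective q ((_ , cre) ∷ X) eq = lookup-annPosFrom-injective (suc q) X eq

  -- Where position y of A ++ B lands in A ++ l ∷ l′ ∷ B, for b = length A.
  punchIn₂ : ℕ → ℕ → ℕ
  punchIn₂ b y = if y <ᵇ b then y else suc (suc y)

  punchIn₂-< : ∀ {b y} → y < b → punchIn₂ b y ≡ y
  punchIn₂-< {b} {y} y<b rewrite dec-true (y ℕ.<? b) y<b = refl

  punchIn₂-≥ : ∀ {b y} → b ≤ y → punchIn₂ b y ≡ suc (suc y)
  punchIn₂-≥ {b} {y} b≤y rewrite dec-false (y ℕ.<? b) (ℕ.≤⇒≯ b≤y) = refl

  punchOut₂ : ℕ → ℕ → ℕ
  punchOut₂ b z = if z <ᵇ b then z else z ∸ 2

  punchOut₂-punchIn₂ : ∀ b y → punchOut₂ b (punchIn₂ b y) ≡ y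
  punchOut₂-punchIn₂ b y with y ℕ.<? b
  ... | yes y<b rewrite punchIn₂-< y<b | dec-true (y ℕ.<? b) y<b = refl
  ... | no  y≮b rewrite punchIn₂-≥ (ℕ.≮⇒≥ y≮b)
    | dec-false (suc (suc y) ℕ.<? b) (λ y+2<b → y≮b (ℕ.<-trans (ℕ.m<n+m y (s≤s z≤n)) y+2<b)) = refl

  punchIn₂-injective : ∀ b {y y′} → punchIn₂ b y ≡ punchIn₂ b y′ → y ≡ y′
  punchIn₂-injective b {y} {y′} eq =
    trans (sym (punchOut₂-punchIn₂ b y)) (trans (cong (punchOut₂ b) eq) (punchOut₂-punchIn₂ b y′))

  punchIn₂-≤ : ∀ b y → punchIn₂ b y ≤ suc (suc y)
  punchIn₂-≤ b y with y <ᵇ b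
  ... | true  = ℕ.≤-trans (ℕ.n≤1+n y) (ℕ.n≤1+n (suc y))
  ... | false = ℕ.≤-refl

  punchIn₂≢suc : ∀ b y → punchIn₂ b y ≢ suc b
  punchIn₂≢suc b y eq with y ℕ.<? b
  ... | yes y<b = ℕ.<⇒≢ (ℕ.<-trans y<b (ℕ.n<1+n b)) (trans (sym (punchIn₂-< y<b)) eq)
  ... | no  y≮b = y≮b (subst (y <_) (ℕ.suc-injective (trans (sym (punchIn₂-≥ (ℕ.≮⇒≥ y≮b))) eq)) (ℕ.n<1+n y))

  ≤ᵇ-punchIn₂-suc : ∀ b y → (suc b ≤ᵇ punchIn₂ b y) ≡ (b ≤ᵇ y)
  ≤ᵇ-punchIn₂-suc b y with y ℕ.<? b
  ... | yes y<b rewrite punchIn₂-< y<b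
    | dec-false (suc b ℕ.≤? y) (ℕ.<⇒≱ (ℕ.<-trans y<b (ℕ.n<1+n b))) | dec-false (b ℕ.≤? y) (ℕ.<⇒≱ y<b) = refl
  ... | no y≮b rewrite punchIn₂-≥ (ℕ.≮⇒≥ y≮b)
    | dec-true (suc b ℕ.≤? suc (suc y)) (s≤s (ℕ.m≤n⇒m≤1+n (ℕ.≮⇒≥ y≮b))) | dec-true (b ℕ.≤? y) (ℕ.≮⇒≥ y≮b) = refl

  ≤ᵇ-punchIn₂-2+ : ∀ b a y → b ≤ a → (suc (suc a) ≤ᵇ punchIn₂ b y) ≡ (a ≤ᵇ y)
  ≤ᵇ-punchIn₂-2+ b a y b≤a with y ℕ.<? b
  ... | yes y<b rewrite punchIn₂-< y<b
    | dec-false (suc (suc a) ℕ.≤? y) (ℕ.<⇒≱ (ℕ.<-≤-trans y<b (ℕ.≤-trans b≤a (ℕ.m≤n+m a 2))))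
    | dec-false (a ℕ.≤? y) (ℕ.<⇒≱ (ℕ.<-≤-trans y<b b≤a)) = refl
  ... | no y≮b rewrite punchIn₂-≥ (ℕ.≮⇒≥ y≮b) with a ℕ.≤? y
  ...   | yes a≤y rewrite dec-true (suc (suc a) ℕ.≤? suc (suc y)) (s≤s (s≤s a≤y)) | dec-true (a ℕ.≤? y) a≤y = refl
  ...   | no  a≰y rewrite dec-false (suc (suc a) ℕ.≤? suc (suc y)) (a≰y ∘ ℕ.≤-pred ∘ ℕ.≤-pred) | dec-false (a ℕ.≤? y) a≰y = refl

  matchFrom-suc : ∀ d q Z → matchFrom d (suc q) Z ≡ suc (matchFrom d q Z)
  matchFrom-suc d       q []              = refl
  matchFrom-suc d       q ((_ , ann) ∷ Z) = matchFrom-suc (suc d) (suc q) Z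
  matchFrom-suc zero    q ((_ , cre) ∷ Z) = refl
  matchFrom-suc (suc d) q ((_ , cre) ∷ Z) = matchFrom-suc d (suc q) Z

  matchFrom-≥ : ∀ d q Z → q ≤ matchFrom d q Z
  matchFrom-≥ d       q []              = ℕ.≤-refl
  matchFrom-≥ d       q ((_ , ann) ∷ Z) = ℕ.≤-trans (ℕ.n≤1+n q) (matchFrom-≥ (suc d) (suc q) Z)
  matchFrom-≥ zero    q ((_ , cre) ∷ Z) = ℕ.≤-refl
  matchFrom-≥ (suc d) q ((_ , cre) ∷ Z) = ℕ.≤-trans (ℕ.n≤1+n q) (matchFrom-≥ d (suc q) Z)

  matchFrom-++-pair : ∀ d q X i j Y →
    matchFrom d q (X ++ (i , ann) ∷ (j , cre) ∷ Y) ≡ punchIn₂ (q + length X) (matchFrom d q (X ++ Y))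
  matchFrom-++-pair d q [] i j Y rewrite ℕ.+-identityʳ q | punchIn₂-≥ (matchFrom-≥ d q Y) =
    trans (matchFrom-suc d (suc q) Y) (cong suc (matchFrom-suc d q Y))
  matchFrom-++-pair d       q ((_ , ann) ∷ X) i j Y rewrite ℕ.+-suc q (length X) = matchFrom-++-pair (suc d) (suc q) X i j Y
  matchFrom-++-pair zero    q ((_ , cre) ∷ X) i j Y = sym (punchIn₂-< (ℕ.m<m+n q (s≤s z≤n)))
  matchFrom-++-pair (suc d) q ((_ , cre) ∷ X) i j Y rewrite ℕ.+-suc q (length X) = matchFrom-++-pair d (suc q) X i j Y

  length-drop-+ : ∀ n (X : Word) → n ≤ length X → n + length (drop n X) ≡ length X
  length-drop-+ n X n≤ = trans (cong (n +_) (List.length-drop n X)) (ℕ.m+[n∸m]≡n n≤)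

  partner-++-pair-< : ∀ A i j Z t → t < length A →
    partner (A ++ (i , ann) ∷ (j , cre) ∷ Z) t ≡ punchIn₂ (length A) (partner (A ++ Z) t)
  partner-++-pair-< A i j Z t t<A
    rewrite drop-++-≤ (suc t) A ((i , ann) ∷ (j , cre) ∷ Z) t<A | drop-++-≤ (suc t) A Z t<A
          | matchFrom-++-pair 0 (suc t) (drop (suc t) A) i j Z | length-drop-+ (suc t) A t<A = refl

  partner-++-pair : ∀ A i j Z → partner (A ++ (i , ann) ∷ (j , cre) ∷ Z) (length A) ≡ suc (length A)
  partner-++-pair A i j Z
    rewrite drop-++-≥ (suc (length A)) A ((i , ann) ∷ (j , cre) ∷ Z) (ℕ.n≤1+n _) | ℕ.m+n∸n≡m 1 (length A) = refl

  shape : Word → List Eps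
  shape = map proj₂

  matchFrom-shape : ∀ d q X Y → shape X ≡ shape Y → matchFrom d q X ≡ matchFrom d q Y
  matchFrom-shape d       q []              []              _  = refl
  matchFrom-shape d       q ((_ , ann) ∷ X) ((_ , ann) ∷ Y) eq = matchFrom-shape (suc d) (suc q) X Y (List.∷-injectiveʳ eq)
  matchFrom-shape zero    q ((_ , cre) ∷ X) ((_ , cre) ∷ Y) eq = refl
  matchFrom-shape (suc d) q ((_ , cre) ∷ X) ((_ , cre) ∷ Y) eq = matchFrom-shape d (suc q) X Y (List.∷-injectiveʳ eq)
  matchFrom-shape d       q ((_ , ann) ∷ X) ((_ , cre) ∷ Y) ()
  matchFrom-shape d       q ((_ , cre) ∷ X) ((_ , ann) ∷ Y) ()

  shape-drop : ∀ n X Y → shape X ≡ shape Y → shape (drop n X) ≡ shape (drop n Y)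
  shape-drop n X Y eq = trans (sym (List.drop-map n X)) (trans (cong (drop n) eq) (List.drop-map n Y))

  partner-shape : ∀ X Y t → shape X ≡ shape Y → partner X t ≡ partner Y t
  partner-shape X Y t eq = matchFrom-shape 0 (suc t) (drop (suc t) X) (drop (suc t) Y) (shape-drop (suc t) X Y eq)

  #ann-shape : ∀ X Y → shape X ≡ shape Y → #ann X ≡ #ann Y
  #ann-shape []              []              _  = refl
  #ann-shape ((_ , ann) ∷ X) ((_ , ann) ∷ Y) eq = cong suc (#ann-shape X Y (List.∷-injectiveʳ eq))
  #ann-shape ((_ , cre) ∷ X) ((_ , cre) ∷ Y) eq = #ann-shape X Y (List.∷-injectiveʳ eq)
  #ann-shape ((_ , ann) ∷ X) ((_ , cre) ∷ Y) ()
  #ann-shape ((_ , cre) ∷ X) ((_ , ann) ∷ Y) ()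

  #cre-shape : ∀ X Y → shape X ≡ shape Y → #cre X ≡ #cre Y
  #cre-shape []              []              _  = refl
  #cre-shape ((_ , ann) ∷ X) ((_ , ann) ∷ Y) eq = #cre-shape X Y (List.∷-injectiveʳ eq)
  #cre-shape ((_ , cre) ∷ X) ((_ , cre) ∷ Y) eq = cong suc (#cre-shape X Y (List.∷-injectiveʳ eq))
  #cre-shape ((_ , ann) ∷ X) ((_ , cre) ∷ Y) ()
  #cre-shape ((_ , cre) ∷ X) ((_ , ann) ∷ Y) ()

  Balanced-shape : ∀ X Y → shape X ≡ shape Y → Balanced X → Balanced Y
  Balanced-shape X Y eq bal = record
    { suffix = λ n → subst₂ _≤_ (#ann-shape _ _ (shape-drop n X Y eq)) (#cre-shape _ _ (shape-drop n X Y eq)) (suffix n)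
    ; total  = trans (sym (#ann-shape X Y eq)) (trans total (#cre-shape X Y eq))
    }
    where open Balanced bal

  length-shape : ∀ X Y → shape X ≡ shape Y → length X ≡ length Y
  length-shape X Y eq = trans (sym (List.length-map proj₂ X)) (trans (cong length eq) (List.length-map proj₂ Y))

  setColour : Word → ℕ → ℕ → Word
  setColour []            k       c = []
  setColour ((_ , ε) ∷ B) zero    c = (c , ε) ∷ B
  setColour (x ∷ B)       (suc k) c = x ∷ setColour B k c

  shape-setColour : ∀ B k c → shape B ≡ shape (setColour B k c)
  shape-setColour []            k       c = refl
  shape-setColour ((_ , ε) ∷ B) zero    c = refl
  shape-setColour (x ∷ B)       (suc k) c = cong (proj₂ x ∷_) (shape-setColour B k c)

  shape-++ˡ : ∀ A X Y → shape X ≡ shape Y → shape (A ++ X) ≡ shape (A ++ Y)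
  shape-++ˡ A X Y eq rewrite List.map-++ proj₂ A X | List.map-++ proj₂ A Y = cong (shape A ++_) eq

  Creators-setColour : ∀ {B} k c → Creators B → Creators (setColour B k c)
  Creators-setColour k       c []          = []
  Creators-setColour zero    c (cr ∷ crs) = cr ∷ crs
  Creators-setColour (suc k) c (cr ∷ crs) = cr ∷ Creators-setColour k c crs

  colourAt-++ˡ : ∀ X Y y → y < length X → colourAt (X ++ Y) y ≡ colourAt X y
  colourAt-++ˡ (x ∷ X) Y zero    _         = refl
  colourAt-++ˡ (x ∷ X) Y (suc y) (s≤s y<X) = colourAt-++ˡ X Y y y<X

  colourAt-++ʳ : ∀ X Y k → colourAt (X ++ Y) (length X + k) ≡ colourAt Y k
  colourAt-++ʳ []      Y k = refl
  colourAt-++ʳ (x ∷ X) Y k = colourAt-++ʳ X Y k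

  colourAt-setColour : ∀ B k c y → k < length B → colourAt (setColour B k c) y ≡ (if y ≡ᵇ k then c else colourAt B y)
  colourAt-setColour ((_ , ε) ∷ B) zero    c zero    _         = refl
  colourAt-setColour ((_ , ε) ∷ B) zero    c (suc y) _         = refl
  colourAt-setColour (x ∷ B)       (suc k) c zero    _         = refl
  colourAt-setColour (x ∷ B)       (suc k) c (suc y) (s≤s k<B) = colourAt-setColour B k c y k<B

  module LastPair (A : Word) (i j : ℕ) (B : Word) (c : Creators B) where

    W U : Word
    W = A ++ (i , ann) ∷ (j , cre) ∷ B
    U = A ++ B

    length-W : length W ≡ suc (suc (length U))
    length-W = length-++-pair A (i , ann) (j , cre) B

    annPositions-W : annPositions W ≡ annPositions U ++ [ length A ]
    annPositions-W = trans (annPositions-++-pair A i j B c) (cong (_++ [ length A ]) (sym (annPositions-++-Creators A B c)))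

    ∈-annPositions-W : ∀ {t} → t ∈ annPositions W → (t ∈ annPositions U × t < length A) ⊎ t ≡ length A
    ∈-annPositions-W {t} t∈ with ∈-++⁻ (annPositions U) (subst (t ∈_) annPositions-W t∈)
    ... | inj₁ t∈U = inj₁ (t∈U , annPositions-< A (subst (t ∈_) (annPositions-++-Creators A B c) t∈U))
    ... | inj₂ (here refl) = inj₂ refl

    partner-W-< : ∀ t → t < length A → partner W t ≡ punchIn₂ (length A) (partner U t)
    partner-W-< = partner-++-pair-< A i j B

    partner-W-last : partner W (length A) ≡ suc (length A)
    partner-W-last = partner-++-pair A i j B

  PartnerBounded : Word → Set
  PartnerBounded W = ∀ {t} → t ∈ annPositions W → partner W t < length W

  partner-< : ∀ W → Balanced W → PartnerBounded W
  partner-< = Balanced-induction PartnerBounded (λ ()) step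
    where
    step : ∀ A i j B c → Balanced (A ++ B) → (∀ V → Balanced V → length V ≤ length (A ++ B) → PartnerBounded V) →
           PartnerBounded (A ++ (i , ann) ∷ (j , cre) ∷ B)
    step A i j B c balU IH {t} t∈ = subst (partner W t <_) (sym length-W) (bound (∈-annPositions-W t∈))
      where
      open LastPair A i j B c
      bound : (t ∈ annPositions U × t < length A) ⊎ t ≡ length A → partner W t < suc (suc (length U))
      bound (inj₁ (t∈U , t<A)) rewrite partner-W-< t t<A =
        s≤s (ℕ.≤-trans (punchIn₂-≤ (length A) (partner U t)) (s≤s (IH U balU ℕ.≤-refl t∈U)))
      bound (inj₂ refl) rewrite partner-W-last =
        s≤s (s≤s (subst (length A ≤_) (sym (List.length-++ A)) (ℕ.m≤m+n (length A) (length B))))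

  PartnerInjective : Word → Set
  PartnerInjective W = ∀ {t t′} → t ∈ annPositions W → t′ ∈ annPositions W → partner W t ≡ partner W t′ → t ≡ t′

  partner-injective : ∀ W → Balanced W → PartnerInjective W
  partner-injective = Balanced-induction PartnerInjective (λ ()) step
    where
    step : ∀ A i j B c → Balanced (A ++ B) → (∀ V → Balanced V → length V ≤ length (A ++ B) → PartnerInjective V) →
           PartnerInjective (A ++ (i , ann) ∷ (j , cre) ∷ B)
    step A i j B c balU IH {t} {t′} t∈ t′∈ eq = cases (∈-annPositions-W t∈) (∈-annPositions-W t′∈)
      where
      open LastPair A i j B c
      cases : (t ∈ annPositions U × t < length A) ⊎ t ≡ length A → (t′ ∈ annPositions U × t′ < length A) ⊎ t′ ≡ length A → t ≡ t′
      cases (inj₁ (t∈U , t<A)) (inj₁ (t′∈U , t′<A)) = IH U balU ℕ.≤-refl t∈U t′∈U (punchIn₂-injective (length A)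
        (trans (sym (partner-W-< t t<A)) (trans eq (partner-W-< t′ t′<A))))
      cases (inj₁ (_ , t<A)) (inj₂ refl) =
        ⊥-elim (punchIn₂≢suc (length A) _ (trans (sym (partner-W-< t t<A)) (trans eq partner-W-last)))
      cases (inj₂ refl) (inj₁ (_ , t′<A)) =
        ⊥-elim (punchIn₂≢suc (length A) _ (trans (sym (partner-W-< t′ t′<A)) (trans (sym eq) partner-W-last)))
      cases (inj₂ refl) (inj₂ refl) = refl

  partnerFrom : Word → ℕ → (ℕ → ℚ) → ℕ → ℚ
  partnerFrom X a H t = if a ≤ᵇ partner X t then H (partner X t) else 0ℚ

  SuffixSum : Word → Set
  SuffixSum U = ∀ a → a ≤ length U → Creators (drop a U) → ∀ H →
    ∑ (annPositions U) (partnerFrom U a H) ≡ ∑[ k < length U ∸ a ] H (a + k)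

  module _ (A : Word) (i j : ℕ) (B : Word) (c : Creators B) where
    open LastPair A i j B c

    length-U : length U ≡ length A + length B
    length-U = List.length-++ A

    ∑-partnerFrom-W : ∀ a a′ H → (∀ y → (a ≤ᵇ punchIn₂ (length A) y) ≡ (a′ ≤ᵇ y)) →
      ∑ (annPositions W) (partnerFrom W a H)
        ≡ ∑ (annPositions U) (partnerFrom U a′ (H ∘ punchIn₂ (length A))) ℚ.+ partnerFrom W a H (length A)
    ∑-partnerFrom-W a a′ H a≤ᵇ≡a′≤ᵇ = begin
      ∑ (annPositions W) (partnerFrom W a H)                                    ≡⟨ cong (λ ps → ∑ ps (partnerFrom W a H)) annPositions-W ⟩
      ∑ (annPositions U ++ [ length A ]) (partnerFrom W a H)                     ≡⟨ ∑-++ (annPositions U) [ length A ] _ ⟩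
      ∑ (annPositions U) (partnerFrom W a H) ℚ.+ (partnerFrom W a H (length A) ℚ.+ 0ℚ)
        ≡⟨ cong₂ ℚ._+_ (∑-cong-∈ (annPositions U) same-term) (ℚ.+-identityʳ _) ⟩
      ∑ (annPositions U) (partnerFrom U a′ (H ∘ punchIn₂ (length A))) ℚ.+ partnerFrom W a H (length A) ∎
      where
      open ≡-Reasoning
      same-term : ∀ {t} → t ∈ annPositions U → partnerFrom W a H t ≡ partnerFrom U a′ (H ∘ punchIn₂ (length A)) t
      same-term {t} t∈U rewrite partner-W-< t (annPositions-< A (subst (t ∈_) (annPositions-++-Creators A B c) t∈U))
        | a≤ᵇ≡a′≤ᵇ (partner U t) = refl

    module _ (IH : SuffixSum U) (H : ℕ → ℚ) where

      ∑-partnerFrom-first : ∑ (annPositions W) (partnerFrom W (suc (length A)) H)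
                              ≡ ∑[ k < length W ∸ suc (length A) ] H (suc (length A) + k)
      ∑-partnerFrom-first = begin
        ∑ (annPositions W) (partnerFrom W (suc (length A)) H)
          ≡⟨ ∑-partnerFrom-W (suc (length A)) (length A) H (≤ᵇ-punchIn₂-suc (length A)) ⟩
        ∑ (annPositions U) (partnerFrom U (length A) (H ∘ punchIn₂ (length A))) ℚ.+ partnerFrom W (suc (length A)) H (length A)
          ≡⟨ cong₂ ℚ._+_ (IH (length A) A≤U (subst Creators (sym (drop-length-++ A B)) c) (H ∘ punchIn₂ (length A))) last ⟩
        ∑[ k < length U ∸ length A ] H (punchIn₂ (length A) (length A + k)) ℚ.+ H (suc (length A) + 0)
          ≡⟨ cong₂ ℚ._+_ (trans (cong (λ n → ∑< n _) U∸A≡B) (∑<-cong (length B) (λ k _ → cong H (shift k)))) refl ⟩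
        ∑[ k < length B ] H (suc (length A) + suc k) ℚ.+ H (suc (length A) + 0)
          ≡⟨ ℚ.+-comm (∑[ k < length B ] H (suc (length A) + suc k)) (H (suc (length A) + 0)) ⟩
        ∑[ k < suc (length B) ] H (suc (length A) + k)
          ≡⟨ cong (λ n → ∑< n (λ k → H (suc (length A) + k))) (sym W∸A≡B) ⟩
        ∑[ k < length W ∸ suc (length A) ] H (suc (length A) + k) ∎
        where
        open ≡-Reasoning
        A≤U : length A ≤ length U
        A≤U = subst (length A ≤_) (sym length-U) (ℕ.m≤m+n (length A) (length B))
        U∸A≡B : length U ∸ length A ≡ length B
        U∸A≡B = trans (cong (_∸ length A) length-U) (ℕ.m+n∸m≡n (length A) (length B))
        W∸A≡B : length W ∸ suc (length A) ≡ suc (length B)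
        W∸A≡B = trans (cong (_∸ suc (length A)) length-W) (trans (ℕ.+-∸-assoc 1 A≤U) (cong suc U∸A≡B))
        shift : ∀ k → punchIn₂ (length A) (length A + k) ≡ suc (length A) + suc k
        shift k = trans (punchIn₂-≥ (ℕ.m≤m+n (length A) k)) (cong suc (sym (ℕ.+-suc (length A) k)))
        last : partnerFrom W (suc (length A)) H (length A) ≡ H (suc (length A) + 0)
        last rewrite partner-W-last | dec-true (suc (length A) ℕ.≤? suc (length A)) ℕ.≤-refl
          | ℕ.+-identityʳ (length A) = refl

      ∑-partnerFrom-later : ∀ a → length A ≤ a → a ≤ length U →
        ∑ (annPositions W) (partnerFrom W (suc (suc a)) H) ≡ ∑[ k < length U ∸ a ] H (suc (suc a) + k)
      ∑-partnerFrom-later a A≤a a≤U = begin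
        ∑ (annPositions W) (partnerFrom W (suc (suc a)) H)
          ≡⟨ ∑-partnerFrom-W (suc (suc a)) a H (λ y → ≤ᵇ-punchIn₂-2+ (length A) a y A≤a) ⟩
        ∑ (annPositions U) (partnerFrom U a (H ∘ punchIn₂ (length A))) ℚ.+ partnerFrom W (suc (suc a)) H (length A)
          ≡⟨ cong₂ ℚ._+_ (IH a a≤U creators (H ∘ punchIn₂ (length A))) last ⟩
        ∑[ k < length U ∸ a ] H (punchIn₂ (length A) (a + k)) ℚ.+ 0ℚ
          ≡⟨ ℚ.+-identityʳ _ ⟩
        ∑[ k < length U ∸ a ] H (punchIn₂ (length A) (a + k))
          ≡⟨ ∑<-cong (length U ∸ a) (λ k _ → cong H (punchIn₂-≥ (ℕ.≤-trans A≤a (ℕ.m≤m+n a k)))) ⟩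
        ∑[ k < length U ∸ a ] H (suc (suc a) + k) ∎
        where
        open ≡-Reasoning
        creators : Creators (drop a U)
        creators = subst Creators (sym (drop-++-≥ a A B A≤a)) (All.drop⁺ (a ∸ length A) c)
        last : partnerFrom W (suc (suc a)) H (length A) ≡ 0ℚ
        last rewrite partner-W-last | dec-false (suc (suc a) ℕ.≤? suc (length A)) (ℕ.<⇒≱ (s≤s (s≤s A≤a))) = refl

  -- t ↦ partner t maps the annihilators partnered inside a suffix of creators bijectively onto that suffix.
  ∑-partnerFrom : ∀ U → Balanced U → SuffixSum U
  ∑-partnerFrom = Balanced-induction SuffixSum base step
    where
    base : SuffixSum []
    base a _ _ H rewrite ℕ.0∸n≡0 a = refl
    step : ∀ A i j B c → Balanced (A ++ B) → (∀ V → Balanced V → length V ≤ length (A ++ B) → SuffixSum V) →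
           SuffixSum (A ++ (i , ann) ∷ (j , cre) ∷ B)
    step A i j B c balU IH a a≤W cW H = from-position a A<a a≤W
      where
      open LastPair A i j B c
      A<a : length A < a
      A<a = ℕ.≰⇒> (λ a≤A → Creators-++-ann (drop a A) i _ (subst Creators (drop-++-≤ a A _ a≤A) cW))
      from-position : ∀ a → length A < a → a ≤ length W →
        ∑ (annPositions W) (partnerFrom W a H) ≡ ∑[ k < length W ∸ a ] H (a + k)
      from-position a A<a a≤W with ℕ.m≤n⇒m<n∨m≡n A<a
      ... | inj₂ refl = ∑-partnerFrom-first A i j B c (IH U balU ℕ.≤-refl) H
      from-position (suc (suc a)) _ a≤W | inj₁ (s≤s (s≤s A≤a)) rewrite length-W =
        ∑-partnerFrom-later A i j B c (IH U balU ℕ.≤-refl) H a A≤a (ℕ.≤-pred (ℕ.≤-pred a≤W))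

module FockSpace where

  open import Data.Integer as ℤ using (ℤ)
  open import Data.Rational using (ℚ; 0ℚ; 1ℚ; _+_; _*_)
  import Data.Rational.Properties as ℚ
  open import Data.List as List using ([]; _∷_; _++_; [_]; length; map)
  import Data.List.Properties as List
  open import Data.List.Relation.Unary.All using (_∷_; [])
  open import Data.Product using (_,_; proj₁)
  open import Relation.Binary.PropositionalEquality hiding ([_])
  open FiniteSums
  open BalancedWords
  open Matching

  vacuumCoeff-++ : ∀ v w → vacuumCoeff (v ++ w) ≡ vacuumCoeff v + vacuumCoeff w
  vacuumCoeff-++ []                w = sym (ℚ.+-identityˡ _)
  vacuumCoeff-++ ((a , []) ∷ v)    w = trans (cong (a +_) (vacuumCoeff-++ v w)) (sym (ℚ.+-assoc a _ _))
  vacuumCoeff-++ ((a , _ ∷ _) ∷ v) w = vacuumCoeff-++ v w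

  vacuumCoeff-scale : ∀ c v → vacuumCoeff (scale c v) ≡ c * vacuumCoeff v
  vacuumCoeff-scale c []                = sym (ℚ.*-zeroʳ c)
  vacuumCoeff-scale c ((a , []) ∷ v)    = trans (cong (c * a +_) (vacuumCoeff-scale c v)) (sym (ℚ.*-distribˡ-+ c a _))
  vacuumCoeff-scale c ((a , _ ∷ _) ∷ v) = vacuumCoeff-scale c v

  scale-* : ∀ a b v → scale (a * b) v ≡ scale a (scale b v)
  scale-* a b []            = refl
  scale-* a b ((x , t) ∷ v) = cong₂ _∷_ (cong (_, t) (ℚ.*-assoc a b x)) (scale-* a b v)

  scale-1 : ∀ v → scale 1ℚ v ≡ v
  scale-1 []            = refl
  scale-1 ((a , t) ∷ v) = cong₂ _∷_ (cong (_, t) (ℚ.*-identityˡ a)) (scale-1 v)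

  module _ (c : ℚ) where

    act-++ : ∀ l v w → act c l (v ++ w) ≡ act c l v ++ act c l w
    act-++ (i , ann) v w = List.concatMap-++ _ v w
    act-++ (i , cre) v w = List.map-++ _ v w

    act-scale : ∀ l a v → act c l (scale a v) ≡ scale a (act c l v)
    act-scale (i , cre) a []            = refl
    act-scale (i , cre) a ((b , t) ∷ v) = cong (_ ∷_) (act-scale (i , cre) a v)
    act-scale (i , ann) a []            = refl
    act-scale (i , ann) a ((b , t) ∷ v) =
      trans (cong₂ _++_ (scale-* a b (annTensor c i t)) (act-scale (i , ann) a v))
            (sym (List.map-++ _ (scale b (annTensor c i t)) (annihilation c i v)))

    act-[] : ∀ l → act c l [] ≡ []
    act-[] (i , ann) = refl
    act-[] (i , cre) = refl

    applyWord-[] : ∀ X → applyWord c X [] ≡ []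
    applyWord-[] []      = refl
    applyWord-[] (l ∷ X) = trans (cong (act c l) (applyWord-[] X)) (act-[] l)

    applyWord-++ : ∀ X v w → applyWord c X (v ++ w) ≡ applyWord c X v ++ applyWord c X w
    applyWord-++ []      v w = refl
    applyWord-++ (l ∷ X) v w = trans (cong (act c l) (applyWord-++ X v w)) (act-++ l _ _)

    applyWord-scale : ∀ X a v → applyWord c X (scale a v) ≡ scale a (applyWord c X v)
    applyWord-scale []      a v = refl
    applyWord-scale (l ∷ X) a v = trans (cong (act c l) (applyWord-scale X a v)) (act-scale l a _)

    applyWord-Creators : ∀ {B} → Creators B → applyWord c B Ωv ≡ (1ℚ , map proj₁ B) ∷ []
    applyWord-Creators []         = refl
    applyWord-Creators (refl ∷ cr) = cong (creation _) (applyWord-Creators cr)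

    amplitude : Word → Vect → ℚ
    amplitude X v = vacuumCoeff (applyWord c X v)

    amplitude-[] : ∀ X → amplitude X [] ≡ 0ℚ
    amplitude-[] X = cong vacuumCoeff (applyWord-[] X)

    amplitude-++ : ∀ X v w → amplitude X (v ++ w) ≡ amplitude X v + amplitude X w
    amplitude-++ X v w = trans (cong vacuumCoeff (applyWord-++ X v w)) (vacuumCoeff-++ (applyWord c X v) _)

    amplitude-scale : ∀ X a v → amplitude X (scale a v) ≡ a * amplitude X v
    amplitude-scale X a v = trans (cong vacuumCoeff (applyWord-scale X a v)) (vacuumCoeff-scale a (applyWord c X v))

    amplitude-∷ : ∀ X a t v → amplitude X ((a , t) ∷ v) ≡ a * amplitude X [ 1ℚ , t ] + amplitude X v
    amplitude-∷ X a t v = trans (amplitude-++ X [ a , t ] v)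
      (cong (_+ amplitude X v) (trans (cong (λ b → amplitude X [ b , t ]) (sym (ℚ.*-identityʳ a)))
                                       (amplitude-scale X a [ 1ℚ , t ])))

    amplitude-swaps : ∀ X i x pre B → amplitude X (swaps i x pre (map proj₁ B)) ≡
      ∑[ k < length B ] (δ i (colourAt B k) * amplitude X [ 1ℚ , pre ++ map proj₁ (setColour B k x) ])
    amplitude-swaps X i x pre []            = amplitude-[] X
    amplitude-swaps X i x pre ((b , ε) ∷ B) = trans (amplitude-∷ X (δ i b) _ _)
      (cong (δ i b * amplitude X [ 1ℚ , pre ++ x ∷ map proj₁ B ] +_)
        (trans (amplitude-swaps X i x (pre ++ [ b ]) B)
          (∑<-cong (length B) (λ k _ → cong (λ t → δ i (colourAt B k) * amplitude X [ 1ℚ , t ])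
            (List.++-assoc pre [ b ] (map proj₁ (setColour B k x)))))))

    applyWord-pair : ∀ i j {B} → Creators B →
      applyWord c ((i , ann) ∷ (j , cre) ∷ B) Ωv ≡ (δ i j , map proj₁ B) ∷ scale c (swaps i j [] (map proj₁ B))
    applyWord-pair i j {B} cr rewrite applyWord-Creators cr =
      trans (List.++-identityʳ _) (scale-1 (annTensor c i (j ∷ map proj₁ B)))

    vacuumCoeff-applyWord-++ : ∀ X Y v → vacuumCoeff (applyWord c (X ++ Y) v) ≡ amplitude X (applyWord c Y v)
    vacuumCoeff-applyWord-++ X Y v = cong vacuumCoeff (List.foldr-++ (act c) v X Y)

  module _ (N : ℤ) (nz : N ≢ ℤ.+ 0) where

    private
      c = invN N nz

    ρ-++-Creators : ∀ A {B} → Creators B → ρ N nz (A ++ B) ≡ amplitude c A [ 1ℚ , map proj₁ B ]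
    ρ-++-Creators A {B} cr = trans (vacuumCoeff-applyWord-++ c A B Ωv) (cong (amplitude c A) (applyWord-Creators c cr))

    ρ-++-pair : ∀ A i j B → Creators B →
      ρ N nz (A ++ (i , ann) ∷ (j , cre) ∷ B) ≡
      δ i j * ρ N nz (A ++ B) + c * ∑[ k < length B ] (δ i (colourAt B k) * ρ N nz (A ++ setColour B k j))
    ρ-++-pair A i j B cr = begin
      ρ N nz (A ++ (i , ann) ∷ (j , cre) ∷ B)
        ≡⟨ vacuumCoeff-applyWord-++ c A _ Ωv ⟩
      amplitude c A (applyWord c ((i , ann) ∷ (j , cre) ∷ B) Ωv)
        ≡⟨ cong (amplitude c A) (applyWord-pair c i j cr) ⟩
      amplitude c A ((δ i j , map proj₁ B) ∷ scale c (swaps i j [] (map proj₁ B)))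
        ≡⟨ amplitude-∷ c A (δ i j) _ _ ⟩
      δ i j * amplitude c A [ 1ℚ , map proj₁ B ] + amplitude c A (scale c (swaps i j [] (map proj₁ B)))
        ≡⟨ cong₂ (λ u v → δ i j * u + v) (sym (ρ-++-Creators A cr)) (amplitude-scale c A c _) ⟩
      δ i j * ρ N nz (A ++ B) + c * amplitude c A (swaps i j [] (map proj₁ B))
        ≡⟨ cong (λ u → δ i j * ρ N nz (A ++ B) + c * u) (trans (amplitude-swaps c A i j [] B)
             (∑<-cong (length B) (λ k _ → cong (δ i (colourAt B k) *_)
               (sym (ρ-++-Creators A (Creators-setColour k j cr)))))) ⟩
      δ i j * ρ N nz (A ++ B) + c * ∑[ k < length B ] (δ i (colourAt B k) * ρ N nz (A ++ setColour B k j)) ∎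
      where open ≡-Reasoning

module AnnihilatorDigraph where

  open import Data.Nat as ℕ using (ℕ; suc; _+_; _∸_; _≤_; _<_; _<ᵇ_; _≤ᵇ_; _≡ᵇ_)
  import Data.Nat.Properties as ℕ
  open import Data.Rational as ℚ using (ℚ; _*_)
  import Data.Rational.Properties as ℚ
  open import Data.Bool using (Bool; true; false; if_then_else_; _∧_)
  import Data.Bool.Properties as Bool
  open import Data.List as List using (List; _++_; [_]; length; allFin)
  import Data.List.Properties as List
  open import Data.List.Membership.Propositional using (_∈_)
  open import Data.List.Membership.Propositional.Properties using (∈-lookup)
  open import Data.Fin using (Fin)
  open import Function using (_∘_)
  open import Relation.Binary.PropositionalEquality hiding ([_])
  open import Relation.Nullary using (yes; no)
  open import Relation.Nullary.Decidable using (dec-true; dec-false)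
  open FiniteSums
  open CycleCovers
  open BalancedWords
  open Matching

  +-≡ᵇ-cancelˡ : ∀ a m k → (a + m ≡ᵇ a + k) ≡ (m ≡ᵇ k)
  +-≡ᵇ-cancelˡ a m k with m ℕ.≟ k
  ... | yes refl rewrite dec-true (m ℕ.≟ m) refl = dec-true (a + m ℕ.≟ a + m) refl
  ... | no  m≢k  rewrite dec-false (m ℕ.≟ k) m≢k = dec-false (a + m ℕ.≟ a + k) (m≢k ∘ ℕ.+-cancelˡ-≡ a m k)

  edgeAt : Word → ℕ → ℕ → Bool
  edgeAt V P Q = (colourAt V P ≡ᵇ colourAt V (partner V Q)) ∧ (P <ᵇ partner V Q)

  module Edges (A : Word) (i j : ℕ) (B : Word) (c : Creators B) where
    open LastPair A i j B c

    a : ℕ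
    a = length A

    colourAt-W-< : ∀ P → P < a → colourAt W P ≡ colourAt U P
    colourAt-W-< P P<a = trans (colourAt-++ˡ A _ P P<a) (sym (colourAt-++ˡ A B P P<a))

    colourAt-W-ann : colourAt W a ≡ i
    colourAt-W-ann = trans (cong (colourAt W) (sym (ℕ.+-identityʳ a))) (colourAt-++ʳ A _ 0)

    colourAt-W-cre : colourAt W (suc a) ≡ j
    colourAt-W-cre = trans (cong (colourAt W) (ℕ.+-comm 1 a)) (colourAt-++ʳ A _ 1)

    colourAt-W-punchIn₂ : ∀ y → colourAt W (punchIn₂ a y) ≡ colourAt U y
    colourAt-W-punchIn₂ y with y ℕ.<? a
    ... | yes y<a rewrite punchIn₂-< y<a = colourAt-W-< y y<a
    ... | no  y≮a rewrite punchIn₂-≥ (ℕ.≮⇒≥ y≮a) = begin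
      colourAt W (suc (suc y))              ≡⟨ cong (λ z → colourAt W (suc (suc z))) (sym y≡a+m) ⟩
      colourAt W (suc (suc (a + m)))        ≡⟨ cong (colourAt W) (sym (trans (ℕ.+-suc a (suc m)) (cong suc (ℕ.+-suc a m)))) ⟩
      colourAt W (a + suc (suc m))          ≡⟨ colourAt-++ʳ A _ (suc (suc m)) ⟩
      colourAt B m                          ≡⟨ sym (colourAt-++ʳ A B m) ⟩
      colourAt U (a + m)                    ≡⟨ cong (colourAt U) y≡a+m ⟩
      colourAt U y                          ∎
      where
      open ≡-Reasoning
      m = y ∸ a
      y≡a+m : a + m ≡ y
      y≡a+m = ℕ.m+[n∸m]≡n (ℕ.≮⇒≥ y≮a)

    <ᵇ-punchIn₂ : ∀ P y → P < a → (P <ᵇ punchIn₂ a y) ≡ (P <ᵇ y)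
    <ᵇ-punchIn₂ P y P<a with y ℕ.<? a
    ... | yes y<a rewrite punchIn₂-< y<a = refl
    ... | no  y≮a rewrite punchIn₂-≥ (ℕ.≮⇒≥ y≮a)
      | dec-true (P ℕ.<? suc (suc y)) (ℕ.<-≤-trans P<a (ℕ.≤-trans (ℕ.≮⇒≥ y≮a) (ℕ.m≤n+m y 2)))
      | dec-true (P ℕ.<? y) (ℕ.<-≤-trans P<a (ℕ.≮⇒≥ y≮a)) = refl

    edgeAt-W-< : ∀ P Q → P < a → Q < a → edgeAt W P Q ≡ edgeAt U P Q
    edgeAt-W-< P Q P<a Q<a rewrite partner-W-< Q Q<a | colourAt-W-punchIn₂ (partner U Q) | colourAt-W-< P P<a
      | <ᵇ-punchIn₂ P (partner U Q) P<a = refl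

    edgeAt-W-into : ∀ P → P < a → edgeAt W P a ≡ (colourAt U P ≡ᵇ j)
    edgeAt-W-into P P<a rewrite partner-W-last | colourAt-W-cre | colourAt-W-< P P<a
      | dec-true (P ℕ.<? suc a) (ℕ.m≤n⇒m≤1+n P<a) = Bool.∧-identityʳ _

    edgeAt-W-from : ∀ Q → Q < a → edgeAt W a Q ≡ (i ≡ᵇ colourAt U (partner U Q)) ∧ (a ≤ᵇ partner U Q)
    edgeAt-W-from Q Q<a rewrite partner-W-< Q Q<a | colourAt-W-punchIn₂ (partner U Q) | colourAt-W-ann
      | ≤ᵇ-punchIn₂-suc a (partner U Q) = refl

    edgeAt-W-loop : edgeAt W a a ≡ (i ≡ᵇ j)
    edgeAt-W-loop rewrite partner-W-last | colourAt-W-ann | colourAt-W-cre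
      | dec-true (a ℕ.<? suc a) (ℕ.n<1+n a) = Bool.∧-identityʳ _

    module Recoloured (k : ℕ) (k<B : k < length B) where

      Uₖ : Word
      Uₖ = A ++ setColour B k j

      partner-Uₖ : ∀ Q → partner Uₖ Q ≡ partner U Q
      partner-Uₖ Q = partner-shape Uₖ U Q (sym (shape-++ˡ A B (setColour B k j) (shape-setColour B k j)))

      colourAt-Uₖ-< : ∀ P → P < a → colourAt Uₖ P ≡ colourAt U P
      colourAt-Uₖ-< P P<a = trans (colourAt-++ˡ A _ P P<a) (sym (colourAt-++ˡ A B P P<a))

      colourAt-Uₖ : ∀ y → colourAt Uₖ y ≡ (if y ≡ᵇ a + k then j else colourAt U y)
      colourAt-Uₖ y with y ℕ.<? a
      ... | yes y<a rewrite dec-false (y ℕ.≟ a + k) (λ y≡ → ℕ.<⇒≱ y<a (subst (a ≤_) (sym y≡) (ℕ.m≤m+n a k))) =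
        colourAt-Uₖ-< y y<a
      ... | no  y≮a = begin
        colourAt Uₖ y                                           ≡⟨ cong (colourAt Uₖ) (sym y≡a+m) ⟩
        colourAt Uₖ (a + m)                                     ≡⟨ colourAt-++ʳ A _ m ⟩
        colourAt (setColour B k j) m                            ≡⟨ colourAt-setColour B k j m k<B ⟩
        (if m ≡ᵇ k then j else colourAt B m)                    ≡⟨ cong₂ (λ b z → if b then j else z) (sym (+-≡ᵇ-cancelˡ a m k)) (sym (colourAt-++ʳ A B m)) ⟩
        (if a + m ≡ᵇ a + k then j else colourAt U (a + m))      ≡⟨ cong (λ z → if z ≡ᵇ a + k then j else colourAt U z) y≡a+m ⟩
        (if y ≡ᵇ a + k then j else colourAt U y)                ∎
        where
        open ≡-Reasoning
        m = y ∸ a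
        y≡a+m : a + m ≡ y
        y≡a+m = ℕ.m+[n∸m]≡n (ℕ.≮⇒≥ y≮a)

      edgeAt-Uₖ-other : ∀ P Q → P < a → partner U Q ≢ a + k → edgeAt Uₖ P Q ≡ edgeAt U P Q
      edgeAt-Uₖ-other P Q P<a ne rewrite partner-Uₖ Q | colourAt-Uₖ (partner U Q) | dec-false (partner U Q ℕ.≟ a + k) ne
        | colourAt-Uₖ-< P P<a = refl

      edgeAt-Uₖ-recoloured : ∀ P Q → P < a → partner U Q ≡ a + k → edgeAt Uₖ P Q ≡ (colourAt U P ≡ᵇ j)
      edgeAt-Uₖ-recoloured P Q P<a eq rewrite partner-Uₖ Q | eq | colourAt-Uₖ (a + k) | dec-true (a + k ℕ.≟ a + k) refl
        | colourAt-Uₖ-< P P<a | dec-true (P ℕ.<? a + k) (ℕ.<-≤-trans P<a (ℕ.m≤m+n a k)) = Bool.∧-identityʳ _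

  Γ-labelled : ∀ V {ps} → annPositions V ≡ ps → ∀ x → cycleCoverPoly (Γ V) x ≡ cycleCoverPoly (labelled (edgeAt V) ps) x
  Γ-labelled V eq x = cong (λ qs → cycleCoverPoly (labelled (edgeAt V) qs) x) eq

  module LastAnnihilator (A : Word) (i j : ℕ) (B : Word) (c : Creators B) (balU : Balanced (A ++ B)) (x : ℚ) where
    open LastPair A i j B c
    open Edges A i j B c

    recolour : ℕ → Word
    recolour k = A ++ setColour B k j

    ps : List ℕ
    ps = annPositions A

    ps-< : ∀ {P} → P ∈ ps → P < a
    ps-< = annPositions-< A

    annPositions-U : annPositions U ≡ ps
    annPositions-U = annPositions-++-Creators A B c

    annPositions-recolour : ∀ k → annPositions (recolour k) ≡ ps
    annPositions-recolour k = annPositions-++-Creators A (setColour B k j) (Creators-setColour k j c)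

    deleted : cycleCoverPoly (labelled (edgeAt W) ps) x ≡ cycleCoverPoly (Γ U) x
    deleted = trans (cycleCoverPoly-labelled-cong ps (λ P∈ Q∈ → edgeAt-W-< _ _ (ps-< P∈) (ps-< Q∈)) x)
                    (sym (Γ-labelled U annPositions-U x))

    partnerOf : Fin (length ps) → ℕ
    partnerOf s = partner U (List.lookup ps s)

    bypassPoly : Fin (length ps) → ℚ
    bypassPoly s = cycleCoverPoly (λ r t → edgeAt W (List.lookup ps r) (if eqF t s then a else List.lookup ps t)) x

    bypassed : ∀ s → a ≤ partnerOf s → bypassPoly s ≡ cycleCoverPoly (Γ (recolour (partnerOf s ∸ a))) x
    bypassed s a≤ = trans (cycleCoverPoly-cong same-edges x) (sym (Γ-labelled (recolour k) (annPositions-recolour k) x))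
      where
      k = partnerOf s ∸ a
      a+k≡ : a + k ≡ partnerOf s
      a+k≡ = ℕ.m+[n∸m]≡n a≤
      s∈U : ∀ s → List.lookup ps s ∈ annPositions U
      s∈U s = subst (List.lookup ps s ∈_) (sym annPositions-U) (∈-lookup s)
      k<B : k < length B
      k<B = ℕ.+-cancelˡ-< a k (length B) (subst₂ _<_ (sym a+k≡) (List.length-++ A) (partner-< U balU (s∈U s)))
      open Recoloured k k<B
      same-edges : ∀ r t → edgeAt W (List.lookup ps r) (if eqF t s then a else List.lookup ps t)
                           ≡ labelled (edgeAt Uₖ) ps r t
      same-edges r t with eqF t s in t≟s
      ... | true with refl ← eqF⇒≡ {x = t} {y = s} t≟s = trans (edgeAt-W-into _ (ps-< (∈-lookup r)))
                                           (sym (edgeAt-Uₖ-recoloured _ _ (ps-< (∈-lookup r)) (sym a+k≡)))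
      ... | false = trans (edgeAt-W-< _ _ (ps-< (∈-lookup r)) (ps-< (∈-lookup t)))
                          (sym (edgeAt-Uₖ-other _ _ (ps-< (∈-lookup r)) t-not-partnered))
        where
        t-not-partnered : partnerOf t ≢ a + k
        t-not-partnered eq with lookup-annPosFrom-injective 0 A (partner-injective U balU (s∈U t) (s∈U s) (trans eq a+k≡))
        ... | refl with () ← trans (sym (eqF-refl t)) t≟s

    recolouredTerm : ℕ → ℚ
    recolouredTerm y = δ i (colourAt U y) * cycleCoverPoly (Γ (recolour (y ∸ a))) x

    bypass-term : ∀ s → indicator (edgeAt W a (List.lookup ps s)) * bypassPoly s
                        ≡ partnerFrom U a recolouredTerm (List.lookup ps s)
    bypass-term s rewrite edgeAt-W-from (List.lookup ps s) (ps-< (∈-lookup s)) with a ≤ᵇ partnerOf s in a≤?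
    ... | false = trans (cong (λ b → indicator b * bypassPoly s) (Bool.∧-zeroʳ (i ≡ᵇ colourAt U (partnerOf s))))
                        (ℚ.*-zeroˡ (bypassPoly s))
    ... | true  = cong₂ _*_ (cong indicator (Bool.∧-identityʳ (i ≡ᵇ colourAt U (partnerOf s))))
                            (bypassed s (ℕ.≤ᵇ⇒≤ a (partnerOf s) (≡true⇒T a≤?)))

    ∑-bypass-terms : ∑[ s ∈ allFin (length ps) ] (indicator (edgeAt W a (List.lookup ps s)) * bypassPoly s)
                     ≡ ∑[ k < length B ] (δ i (colourAt B k) * cycleCoverPoly (Γ (recolour k)) x)
    ∑-bypass-terms = begin
      ∑[ s ∈ allFin (length ps) ] (indicator (edgeAt W a (List.lookup ps s)) * bypassPoly s)
                                                                          ≡⟨ ∑-cong (allFin (length ps)) bypass-term ⟩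
      ∑[ s ∈ allFin (length ps) ] partnerFrom U a recolouredTerm (List.lookup ps s)
                                                                          ≡⟨ ∑-lookup ps (partnerFrom U a recolouredTerm) ⟩
      ∑ ps (partnerFrom U a recolouredTerm)                               ≡⟨ cong (λ qs → ∑ qs (partnerFrom U a recolouredTerm)) (sym annPositions-U) ⟩
      ∑ (annPositions U) (partnerFrom U a recolouredTerm)                 ≡⟨ ∑-partnerFrom U balU a a≤U creators recolouredTerm ⟩
      ∑[ k < length U ∸ a ] recolouredTerm (a + k)                        ≡⟨ cong (λ n → ∑< n (λ k → recolouredTerm (a + k))) U∸a≡B ⟩
      ∑[ k < length B ] recolouredTerm (a + k)                            ≡⟨ ∑<-cong (length B) (λ k _ → cong₂ (λ y z → δ i y * cycleCoverPoly (Γ (recolour z)) x)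
                                                                               (colourAt-++ʳ A B k) (ℕ.m+n∸m≡n a k)) ⟩
      ∑[ k < length B ] (δ i (colourAt B k) * cycleCoverPoly (Γ (recolour k)) x) ∎
      where
      open ≡-Reasoning
      a≤U : a ≤ length U
      a≤U = subst (a ≤_) (sym (List.length-++ A)) (ℕ.m≤m+n a (length B))
      creators : Creators (List.drop a U)
      creators = subst Creators (sym (drop-length-++ A B)) c
      U∸a≡B : length U ∸ a ≡ length B
      U∸a≡B = trans (cong (_∸ a) (List.length-++ A)) (ℕ.m+n∸m≡n a (length B))

    cycleCoverPoly-Γ-W : cycleCoverPoly (Γ W) x ≡
      ∑[ k < length B ] (δ i (colourAt B k) * cycleCoverPoly (Γ (recolour k)) x) ℚ.+ δ i j * (x * cycleCoverPoly (Γ U) x)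
    cycleCoverPoly-Γ-W = begin
      cycleCoverPoly (Γ W) x                                   ≡⟨ Γ-labelled W (annPositions-++-pair A i j B c) x ⟩
      cycleCoverPoly (labelled (edgeAt W) (ps ++ [ a ])) x     ≡⟨ cycleCoverPoly-labelled-∷ʳ ps a (edgeAt W) x ⟩
      ∑[ s ∈ allFin (length ps) ] (indicator (edgeAt W a (List.lookup ps s)) * bypassPoly s)
        ℚ.+ indicator (edgeAt W a a) * (x * cycleCoverPoly (labelled (edgeAt W) ps) x)
        ≡⟨ cong₂ ℚ._+_ ∑-bypass-terms (cong₂ _*_ (cong indicator edgeAt-W-loop) (cong (x *_) deleted)) ⟩
      ∑[ k < length B ] (δ i (colourAt B k) * cycleCoverPoly (Γ (recolour k)) x) ℚ.+ δ i j * (x * cycleCoverPoly (Γ U) x) ∎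
      where open ≡-Reasoning

module Recursion where

  open import Data.Nat as ℕ using (ℕ; zero; suc; _≤_)
  import Data.Nat.Properties as ℕ
  import Data.Nat.Coprimality as Coprime
  open import Data.Integer as ℤ using (ℤ)
  open import Data.Rational as ℚ using (ℚ; 1ℚ; _*_)
  import Data.Rational.Properties as ℚ
  open import Data.List using (_∷_; _++_; length)
  open import Data.Product using (_,_)
  open import Data.Empty using (⊥-elim)
  open import Algebra.Bundles using (CommutativeMonoid)
  open import Relation.Binary.PropositionalEquality
  open FiniteSums
  open CycleCovers using (length-∷ʳ)
  open BalancedWords
  open Matching
  open FockSpace
  open AnnihilatorDigraph

  invN*toℚ≡1 : ∀ (N : ℤ) (nz : N ≢ ℤ.+ 0) → invN N nz * toℚ N ≡ 1ℚ
  invN*toℚ≡1 (ℤ.+ zero) nz = ⊥-elim (nz refl)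
  invN*toℚ≡1 (ℤ.+ suc k) nz rewrite ℚ.normalize-coprime {1} {k} (Coprime.1-coprimeTo (suc k))
    | ℚ.normalize-coprime {suc k} {0} (Coprime.sym (Coprime.1-coprimeTo (suc k))) =
    ℚ.*-inverseˡ (ℚ.mkℚ (ℤ.+ suc k) 0 (Coprime.sym (Coprime.1-coprimeTo (suc k))))
  invN*toℚ≡1 ℤ.-[1+ k ] nz rewrite ℚ.normalize-coprime {1} {k} (Coprime.1-coprimeTo (suc k))
    | ℚ.normalize-coprime {suc k} {0} (Coprime.sym (Coprime.1-coprimeTo (suc k))) =
    ℚ.*-inverseˡ (ℚ.- ℚ.mkℚ (ℤ.+ suc k) 0 (Coprime.sym (Coprime.1-coprimeTo (suc k))))

  regroup-by-inverse : ∀ {c x : ℚ} → c * x ≡ 1ℚ → ∀ d P U S →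
    d * (P * U) ℚ.+ c * (P * S) ≡ (c * P) * (S ℚ.+ d * (x * U))
  regroup-by-inverse {c} {x} cx≡1 d P U S = begin
    d * (P * U) ℚ.+ c * (P * S)                 ≡⟨ cong (ℚ._+ c * (P * S)) (sym (ℚ.*-identityˡ (d * (P * U)))) ⟩
    1ℚ * (d * (P * U)) ℚ.+ c * (P * S)          ≡⟨ cong (λ z → z * (d * (P * U)) ℚ.+ c * (P * S)) (sym cx≡1) ⟩
    (c * x) * (d * (P * U)) ℚ.+ c * (P * S)     ≡⟨ solve 6 (λ c x P S d U → (c :* x) :* (d :* (P :* U)) :+ c :* (P :* S)
                                                                      := (c :* P) :* (S :+ d :* (x :* U))) refl c x P S d U ⟩
    (c * P) * (S ℚ.+ d * (x * U))               ∎
    where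
    open ≡-Reasoning
    open import Data.Rational.Solver
    open +-*-Solver

  module _ (N : ℤ) (nz : N ≢ ℤ.+ 0) where

    private
      c x : ℚ
      c = invN N nz
      x = toℚ N

    Formula : Word → Set
    Formula V = ρ N nz V ≡ pow c (nAnn V) * cycleCoverPoly (Γ V) x

    formula-step : ∀ A i j B cr → Balanced (A ++ B) → (∀ V → Balanced V → length V ≤ length (A ++ B) → Formula V) →
      Formula (A ++ (i , ann) ∷ (j , cre) ∷ B)
    formula-step A i j B cr balU IH = begin
      ρ N nz W
        ≡⟨ ρ-++-pair N nz A i j B cr ⟩
      δ i j * ρ N nz U ℚ.+ c * ∑[ k < length B ] (δ i (colourAt B k) * ρ N nz (recolour k))
        ≡⟨ cong₂ (λ u v → δ i j * u ℚ.+ c * v) IH-U (∑<-cong (length B) (λ k _ → cong (δ i (colourAt B k) *_) (IH-recolour k))) ⟩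
      δ i j * (P * CU) ℚ.+ c * ∑[ k < length B ] (δ i (colourAt B k) * (P * C k))
        ≡⟨ cong (λ v → δ i j * (P * CU) ℚ.+ c * v) (trans (∑<-cong (length B) (λ k _ → x∙yz≈y∙xz (δ i (colourAt B k)) P (C k)))
                                                            (*-distribˡ-∑< (length B) P _)) ⟩
      δ i j * (P * CU) ℚ.+ c * (P * S)
        ≡⟨ regroup-by-inverse {c} {x} (invN*toℚ≡1 N nz) (δ i j) P CU S ⟩
      (c * P) * (S ℚ.+ δ i j * (x * CU))
        ≡⟨ cong₂ _*_ (cong (pow c) (sym nAnn-W)) (sym cycleCoverPoly-Γ-W) ⟩
      pow c (nAnn W) * cycleCoverPoly (Γ W) x ∎
      where
      open ≡-Reasoning
      open LastPair A i j B cr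
      open LastAnnihilator A i j B cr balU x
      open import Algebra.Properties.CommutativeSemigroup
        (CommutativeMonoid.commutativeSemigroup ℚ.*-1-commutativeMonoid) using (x∙yz≈y∙xz)
      P CU : ℚ
      P = pow c (length ps)
      CU = cycleCoverPoly (Γ U) x
      C : ℕ → ℚ
      C k = cycleCoverPoly (Γ (recolour k)) x
      S : ℚ
      S = ∑[ k < length B ] (δ i (colourAt B k) * C k)
      nAnn-W : nAnn W ≡ suc (length ps)
      nAnn-W = trans (cong length (annPositions-++-pair A i j B cr)) (length-∷ʳ ps (length A))
      IH-U : ρ N nz U ≡ P * CU
      IH-U = trans (IH U balU ℕ.≤-refl) (cong (λ n → pow c n * CU) (cong length annPositions-U))
      IH-recolour : ∀ k → ρ N nz (recolour k) ≡ P * C k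
      IH-recolour k = trans
        (IH (recolour k) (Balanced-shape U (recolour k) U≈Uₖ balU) (ℕ.≤-reflexive (sym (length-shape U _ U≈Uₖ))))
        (cong (λ n → pow c n * C k) (cong length (annPositions-recolour k)))
        where
        U≈Uₖ : shape U ≡ shape (recolour k)
        U≈Uₖ = shape-++ˡ A B (setColour B k j) (shape-setColour B k j)

    formula : ∀ V → Balanced V → Formula V
    formula = Balanced-induction Formula refl formula-step

open import Data.Integer using (ℤ; +_)
open import Data.Rational using (_*_)
open import Relation.Binary.PropositionalEquality using (_≡_; _≢_)

mainTheorem12 : (N : ℤ) (nz : N ≢ + 0) (W : Word) → IsDyck W →
    ρ N nz W ≡ pow (invN N nz) (nAnn W) * cycleCoverPoly (Γ W) (toℚ N)
mainTheorem12 N nz W dyck = Recursion.formula N nz W (BalancedWords.IsDyck⇒Balanced W dyck)
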